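{- The map sending an oriented Gaussian circle $M(\mathbb{R})$, where $M=\begin{pmatrix} a & b\end{pmatrix}\in\mathrm{PGL}_2(\mathbb{Z}[i])$ has columns $a,b\in\mathbb{Z}[i]^2$, to the lax lattice with ordered basis $(a,b)$ is well defined (independent of the choice of $M$ and of its representative matrix) and is a bijection from the set of oriented Gaussian circles to the set of lax lattices.
   Context: Circles in $\mathbb{C}_\infty$ include lines; an oriented circle has a direction of travel, and $\mathbb{R}$ is oriented toward $+\infty$. $\mathrm{PGL}_2(\mathbb{Z}[i])$ is the group of $2\times2$ matrices over $\mathbb{Z}[i]$ with determinant a unit ($\pm1,\pm i$), modulo unit scalars; it acts on $\mathbb{C}_\infty$ by M\"obius transformations and on oriented circles (the orientation of the image is the direction visiting the images of three points in the same order). An oriented Gaussian circle is an oriented circle of the form $M(\mathbb{R})$ with $M\in\mathrm{PGL}_2(\mathbb{Z}[i])$. A lax lattice: for an ordered $\mathbb{Z}[i]$-basis $(a,b)$ of $\mathbb{Z}[i]^2$, let $L=\mathbb{Z}a+\mathbb{Z}b$, a rank-2 $\mathbb{Z}$-submodule of $\mathbb{Z}[i]^2$ (viewed as a rank-4 $\mathbb{Z}$-module), oriented by $(a,b)$, where ordered $\mathbb{Z}$-bases related by a change of basis of determinant $1$ give the same orientation and of determinant $-1$ the opposite one; the lax lattice with ordered basis $(a,b)$ is the pair $\{L,iL\}$, with $iL$ oriented by $(ia,ib)$. -}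

module Defs where

open import Data.Integer as ℤ using (ℤ; +_; -[1+_])
open import Data.Rational as ℚ using (ℚ)
open import Data.Unit using (⊤)
open import Data.Empty using (⊥)
open import Data.Maybe using (Maybe; just; nothing)
open import Data.Product using (Σ; ∃; ∃-syntax; _×_; _,_)
open import Data.Sum using (_⊎_)
open import Relation.Binary.PropositionalEquality using (_≡_)

record ℤ[i] : Set where
  constructor _+_i
  field
    re : ℤ
    im : ℤ
open ℤ[i] public

infixl 6 _+ᵍ_ _-ᵍ_
infixl 7 _*ᵍ_

_+ᵍ_ : ℤ[i] → ℤ[i] → ℤ[i]
(a + b i) +ᵍ (c + d i) = (a ℤ.+ c) + (b ℤ.+ d) i

-ᵍ_ : ℤ[i] → ℤ[i]
-ᵍ (a + b i) = (ℤ.- a) + (ℤ.- b) i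

_-ᵍ_ : ℤ[i] → ℤ[i] → ℤ[i]
x -ᵍ y = x +ᵍ (-ᵍ y)

_*ᵍ_ : ℤ[i] → ℤ[i] → ℤ[i]
(a + b i) *ᵍ (c + d i) = (a ℤ.* c ℤ.- b ℤ.* d) + (a ℤ.* d ℤ.+ b ℤ.* c) i

0ᵍ 1ᵍ iᵍ : ℤ[i]
0ᵍ = (+ 0) + (+ 0) i
1ᵍ = (+ 1) + (+ 0) i
iᵍ = (+ 0) + (+ 1) i

IsUnit : ℤ[i] → Set
IsUnit u = (u ≡ 1ᵍ) ⊎ (u ≡ -ᵍ 1ᵍ) ⊎ (u ≡ iᵍ) ⊎ (u ≡ -ᵍ iᵍ)

record V : Set where
  constructor ⟨_,_⟩
  field
    fst : ℤ[i]
    snd : ℤ[i]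
open V public

infixl 6 _+ᵛ_
infixr 7 _·ᵛ_ _·ℤ_

_+ᵛ_ : V → V → V
⟨ x , y ⟩ +ᵛ ⟨ x' , y' ⟩ = ⟨ x +ᵍ x' , y +ᵍ y' ⟩

_·ᵛ_ : ℤ[i] → V → V
c ·ᵛ ⟨ x , y ⟩ = ⟨ c *ᵍ x , c *ᵍ y ⟩

_·ℤ_ : ℤ → V → V
n ·ℤ v = (n + (+ 0) i) ·ᵛ v

0ᵛ : V
0ᵛ = ⟨ 0ᵍ , 0ᵍ ⟩

IsBasis : V → V → Set
IsBasis a b =
  (∀ (v : V) → ∃[ x ] ∃[ y ] (v ≡ x ·ᵛ a +ᵛ y ·ᵛ b)) ×
  (∀ (x y : ℤ[i]) → x ·ᵛ a +ᵛ y ·ᵛ b ≡ 0ᵛ → (x ≡ 0ᵍ) × (y ≡ 0ᵍ))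

-- The oriented lattice ℤu + ℤv (oriented by (u,v)) equals the oriented
-- lattice ℤu' + ℤv' (oriented by (u',v')): the ordered bases are related
-- by an integral change of basis of determinant 1 (in particular the
-- spans coincide).
SameOrientedLattice : V × V → V × V → Set
SameOrientedLattice (u , v) (u' , v') =
  ∃[ p ] ∃[ q ] ∃[ r ] ∃[ s ]
    (u' ≡ p ·ℤ u +ᵛ q ·ℤ v) × (v' ≡ r ·ℤ u +ᵛ s ·ℤ v) ×
    (p ℤ.* s ℤ.- q ℤ.* r ≡ + 1)

-- The lax lattice with ordered basis (a,b) is the unordered pair
-- { L(a,b) , L(ia,ib) } of oriented lattices; equality of two lax lattices
-- is equality of these unordered pairs.
SameLaxLattice : V × V → V × V → Set
SameLaxLattice (a , b) (a' , b') =
  (SameOrientedLattice (a , b) (a' , b') ×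
   SameOrientedLattice (iᵍ ·ᵛ a , iᵍ ·ᵛ b) (iᵍ ·ᵛ a' , iᵍ ·ᵛ b'))
  ⊎
  (SameOrientedLattice (a , b) (iᵍ ·ᵛ a' , iᵍ ·ᵛ b') ×
   SameOrientedLattice (iᵍ ·ᵛ a , iᵍ ·ᵛ b) (a' , b'))

-- 2×2 matrices over ℤ[i] with unit determinant (representatives of PGL₂(ℤ[i]))

record Mat : Set where
  constructor mat
  field
    m₁₁ m₁₂ m₂₁ m₂₂ : ℤ[i]
open Mat public

det : Mat → ℤ[i]
det M = m₁₁ M *ᵍ m₂₂ M -ᵍ m₁₂ M *ᵍ m₂₁ M

GL₂ : Set
GL₂ = Σ Mat λ M → IsUnit (det M)

cols : GL₂ → V × V
cols (mat p q r s , _) = ⟨ p , r ⟩ , ⟨ q , s ⟩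

record ℚ[i] : Set where
  constructor _+_iq
  field
    req : ℚ
    imq : ℚ

infixl 6 _+q_
infixl 7 _*q_
infix 4 _≈ₚ_ _<∞_

_*q_ : ℚ[i] → ℚ[i] → ℚ[i]
(a + b iq) *q (c + d iq) = (a ℚ.* c ℚ.- b ℚ.* d) + (a ℚ.* d ℚ.+ b ℚ.* c) iq

_+q_ : ℚ[i] → ℚ[i] → ℚ[i]
(a + b iq) +q (c + d iq) = (a ℚ.+ c) + (b ℚ.+ d) iq

ι : ℤ[i] → ℚ[i]
ι (a + b i) = (a ℚ./ 1) + (b ℚ./ 1) iq

ιℚ : ℚ → ℚ[i]
ιℚ t = t + ℚ.0ℚ iq

-- a point [z : w] of ℂ∞ = P¹(ℂ) (only nonzero pairs occur below)
Pt : Set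
Pt = ℚ[i] × ℚ[i]

_≈ₚ_ : Pt → Pt → Set
(z , w) ≈ₚ (z' , w') = z *q w' ≡ z' *q w

-- ℚ∞ = ℚ ∪ {∞} ⊂ ℝ∞  (nothing = ∞)
ℚ∞ : Set
ℚ∞ = Maybe ℚ

act : GL₂ → ℚ∞ → Pt
act (mat p q r s , _) (just t) = (ι p *q ιℚ t +q ι q) , (ι r *q ιℚ t +q ι s)
act (mat p q r s , _) nothing  = ι p , ι r

_<∞_ : ℚ∞ → ℚ∞ → Set
just x  <∞ just y  = x ℚ.< y
just _  <∞ nothing = ⊤
nothing <∞ _       = ⊥

-- (x , y , z) is visited in this order by ℝ∞ travelled in its orientation
Cyclic : ℚ∞ → ℚ∞ → ℚ∞ → Set
Cyclic x y z = ((x <∞ y) × (y <∞ z)) ⊎ ((y <∞ z) × (z <∞ x)) ⊎ ((z <∞ x) × (x <∞ y))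

-- The oriented circles M(ℝ) and N(ℝ) coincide: same point set (tested on the
-- points with coordinates in ℚ(i), i.e. M(ℚ∞) = N(ℚ∞)), and the orientation of
-- M(ℝ), namely the direction visiting M(0), M(1), M(∞) in that order, is the
-- orientation of N(ℝ).
SameOrientedCircle : GL₂ → GL₂ → Set
SameOrientedCircle M N =
  (∀ t → ∃[ s ] (act M t ≈ₚ act N s)) ×
  (∀ s → ∃[ t ] (act N s ≈ₚ act M t)) ×
  (∃[ s₀ ] ∃[ s₁ ] ∃[ s∞ ]
     (act M (just ℚ.0ℚ) ≈ₚ act N s₀) × (act M (just ℚ.1ℚ) ≈ₚ act N s₁) ×
     (act M nothing ≈ₚ act N s∞) × Cyclic s₀ s₁ s∞)

{-# OPTIONS --safe #-}
-- Write M = (a b) by columns. As det M is a unit, Cramer's rule makes (a , b) a ℤ[i]-basis; conversely the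
-- determinant of a basis is a unit, so every lax lattice comes from a matrix.
-- If the lax lattices of M and N agree then N = c M R with c a unit and R ∈ SL₂(ℤ); so M and N trace the same
-- points, and R preserves the cyclic order of ℝ∞ because the product of the three differences of
-- R(0), R(1), R(∞) has the sign of det R.
-- Conversely, if M(ℝ) = N(ℝ) as oriented circles, the columns of K = adj(N) M and their sum are complex
-- multiples of real vectors. Writing K = A + iB, the imaginary part of the unit det K is then even, hence 0,
-- which forces A = 0 or B = 0: K = w R with w ∈ {1, i} and det R = ±1. Orientation forces det R = 1, and
-- det(N) M = w N R says that the two lax lattices agree.

module Submission where

open import Defs
open import Data.Integer as ℤ using (ℤ; +_; -[1+_])
import Data.Integer.Properties as ℤP
open import Data.Integer.Tactic.RingSolver using (solve-∀)
import Data.Nat as ℕ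
import Data.Nat.Properties as ℕP
import Data.Nat.Coprimality as Coprime
open import Data.Rational as ℚ using (ℚ; mkℚ; 0ℚ; 1ℚ; _<_)
import Data.Rational.Properties as ℚP
import Data.Sign.Properties as SignP
open import Data.Maybe using (just; nothing)
open import Data.Product using (_×_; _,_; ∃-syntax; proj₁; proj₂)
open import Data.Sum using (_⊎_; inj₁; inj₂)
open import Data.Unit using (tt)
open import Data.Empty using (⊥-elim)
open import Function.Bundles using (_⇔_; mk⇔; Equivalence)
import Function.Properties.Equivalence as ⇔
open import Level using (0ℓ)
open import Relation.Nullary using (¬_; yes; no; contradiction)
open import Relation.Binary.Definitions using (tri<; tri≈; tri>)
open import Relation.Binary.PropositionalEquality
open import Algebra.Bundles using (CommutativeRing)
open import Algebra.Structures using (IsCommutativeRing)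
open import Algebra.Consequences.Propositional using (comm∧idˡ⇒id; comm∧distrˡ⇒distrʳ; comm∧invˡ⇒inv)
import Tactic.RingSolver.Core.AlmostCommutativeRing as ACR
open import Tactic.RingSolver using () renaming (solve-∀ to solve-∀-in)

open ℚ[i] using (req; imq)

private module ℤ[i]-laws where
  *-assoc-re : ∀ a b c d e f →
    (a ℤ.* c ℤ.- b ℤ.* d) ℤ.* e ℤ.- (a ℤ.* d ℤ.+ b ℤ.* c) ℤ.* f ≡
    a ℤ.* (c ℤ.* e ℤ.- d ℤ.* f) ℤ.- b ℤ.* (c ℤ.* f ℤ.+ d ℤ.* e)
  *-assoc-re = solve-∀
  *-assoc-im : ∀ a b c d e f →
    (a ℤ.* c ℤ.- b ℤ.* d) ℤ.* f ℤ.+ (a ℤ.* d ℤ.+ b ℤ.* c) ℤ.* e ≡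
    a ℤ.* (c ℤ.* f ℤ.+ d ℤ.* e) ℤ.+ b ℤ.* (c ℤ.* e ℤ.- d ℤ.* f)
  *-assoc-im = solve-∀
  *-comm-re : ∀ a b c d → a ℤ.* c ℤ.- b ℤ.* d ≡ c ℤ.* a ℤ.- d ℤ.* b
  *-comm-re = solve-∀
  *-comm-im : ∀ a b c d → a ℤ.* d ℤ.+ b ℤ.* c ≡ c ℤ.* b ℤ.+ d ℤ.* a
  *-comm-im = solve-∀
  *-identityˡ-re : ∀ a b → + 1 ℤ.* a ℤ.- + 0 ℤ.* b ≡ a
  *-identityˡ-re = solve-∀
  *-identityˡ-im : ∀ a b → + 1 ℤ.* b ℤ.+ + 0 ℤ.* a ≡ b
  *-identityˡ-im = solve-∀
  distribˡ-re : ∀ a b c d e f →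
    a ℤ.* (c ℤ.+ e) ℤ.- b ℤ.* (d ℤ.+ f) ≡ (a ℤ.* c ℤ.- b ℤ.* d) ℤ.+ (a ℤ.* e ℤ.- b ℤ.* f)
  distribˡ-re = solve-∀
  distribˡ-im : ∀ a b c d e f →
    a ℤ.* (d ℤ.+ f) ℤ.+ b ℤ.* (c ℤ.+ e) ≡ (a ℤ.* d ℤ.+ b ℤ.* c) ℤ.+ (a ℤ.* f ℤ.+ b ℤ.* e)
  distribˡ-im = solve-∀

ℤ[i]-isCommutativeRing : IsCommutativeRing _≡_ _+ᵍ_ _*ᵍ_ (λ x → -ᵍ x) 0ᵍ 1ᵍ
ℤ[i]-isCommutativeRing = record
  { isRing = record
    { +-isAbelianGroup = record
      { isGroup = record
        { isMonoid = record
          { isSemigroup = record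
            { isMagma = record { isEquivalence = isEquivalence ; ∙-cong = cong₂ _+ᵍ_ }
            ; assoc = λ x y z → cong₂ _+_i (ℤP.+-assoc (re x) (re y) (re z)) (ℤP.+-assoc (im x) (im y) (im z))
            }
          ; identity = comm∧idˡ⇒id +-comm λ x → cong₂ _+_i (ℤP.+-identityˡ (re x)) (ℤP.+-identityˡ (im x))
          }
        ; inverse = comm∧invˡ⇒inv +-comm λ x → cong₂ _+_i (ℤP.+-inverseˡ (re x)) (ℤP.+-inverseˡ (im x))
        ; ⁻¹-cong = cong (λ x → -ᵍ x)
        }
      ; comm = +-comm
      }
    ; *-cong = cong₂ _*ᵍ_
    ; *-assoc = λ x y z → cong₂ _+_i (*-assoc-re (re x) (im x) (re y) (im y) (re z) (im z))
                                      (*-assoc-im (re x) (im x) (re y) (im y) (re z) (im z))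
    ; *-identity = comm∧idˡ⇒id *-comm λ x → cong₂ _+_i (*-identityˡ-re (re x) (im x)) (*-identityˡ-im (re x) (im x))
    ; distrib = distribˡ , comm∧distrˡ⇒distrʳ *-comm distribˡ
    }
  ; *-comm = *-comm
  }
  where
  open ℤ[i]-laws
  +-comm : ∀ x y → x +ᵍ y ≡ y +ᵍ x
  +-comm x y = cong₂ _+_i (ℤP.+-comm (re x) (re y)) (ℤP.+-comm (im x) (im y))
  *-comm : ∀ x y → x *ᵍ y ≡ y *ᵍ x
  *-comm x y = cong₂ _+_i (*-comm-re (re x) (im x) (re y) (im y)) (*-comm-im (re x) (im x) (re y) (im y))
  distribˡ : ∀ x y z → x *ᵍ (y +ᵍ z) ≡ x *ᵍ y +ᵍ x *ᵍ z
  distribˡ x y z = cong₂ _+_i (distribˡ-re (re x) (im x) (re y) (im y) (re z) (im z))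
                              (distribˡ-im (re x) (im x) (re y) (im y) (re z) (im z))

ℚ-ring : ACR.AlmostCommutativeRing 0ℓ 0ℓ
ℚ-ring = ACR.fromCommutativeRing ℚP.+-*-commutativeRing isZero
  where
  isZero : ∀ x → _
  isZero x with 0ℚ ℚP.≟ x
  ... | yes x≡0 = just x≡0
  ... | no _ = nothing

infix 8 -q_
-q_ : ℚ[i] → ℚ[i]
-q (a + b iq) = (ℚ.- a) + (ℚ.- b) iq

0q 1q : ℚ[i]
0q = 0ℚ + 0ℚ iq
1q = 1ℚ + 0ℚ iq

private module ℚ[i]-laws where
  *-assoc-re : ∀ a b c d e f →
    (a ℚ.* c ℚ.- b ℚ.* d) ℚ.* e ℚ.- (a ℚ.* d ℚ.+ b ℚ.* c) ℚ.* f ≡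
    a ℚ.* (c ℚ.* e ℚ.- d ℚ.* f) ℚ.- b ℚ.* (c ℚ.* f ℚ.+ d ℚ.* e)
  *-assoc-re = solve-∀-in ℚ-ring
  *-assoc-im : ∀ a b c d e f →
    (a ℚ.* c ℚ.- b ℚ.* d) ℚ.* f ℚ.+ (a ℚ.* d ℚ.+ b ℚ.* c) ℚ.* e ≡
    a ℚ.* (c ℚ.* f ℚ.+ d ℚ.* e) ℚ.+ b ℚ.* (c ℚ.* e ℚ.- d ℚ.* f)
  *-assoc-im = solve-∀-in ℚ-ring
  *-comm-re : ∀ a b c d → a ℚ.* c ℚ.- b ℚ.* d ≡ c ℚ.* a ℚ.- d ℚ.* b
  *-comm-re = solve-∀-in ℚ-ring
  *-comm-im : ∀ a b c d → a ℚ.* d ℚ.+ b ℚ.* c ≡ c ℚ.* b ℚ.+ d ℚ.* a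
  *-comm-im = solve-∀-in ℚ-ring
  *-identityˡ-re : ∀ a b → 1ℚ ℚ.* a ℚ.- 0ℚ ℚ.* b ≡ a
  *-identityˡ-re = solve-∀-in ℚ-ring
  *-identityˡ-im : ∀ a b → 1ℚ ℚ.* b ℚ.+ 0ℚ ℚ.* a ≡ b
  *-identityˡ-im = solve-∀-in ℚ-ring
  distribˡ-re : ∀ a b c d e f →
    a ℚ.* (c ℚ.+ e) ℚ.- b ℚ.* (d ℚ.+ f) ≡ (a ℚ.* c ℚ.- b ℚ.* d) ℚ.+ (a ℚ.* e ℚ.- b ℚ.* f)
  distribˡ-re = solve-∀-in ℚ-ring
  distribˡ-im : ∀ a b c d e f →
    a ℚ.* (d ℚ.+ f) ℚ.+ b ℚ.* (c ℚ.+ e) ≡ (a ℚ.* d ℚ.+ b ℚ.* c) ℚ.+ (a ℚ.* f ℚ.+ b ℚ.* e)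
  distribˡ-im = solve-∀-in ℚ-ring

ℚ[i]-isCommutativeRing : IsCommutativeRing _≡_ _+q_ _*q_ -q_ 0q 1q
ℚ[i]-isCommutativeRing = record
  { isRing = record
    { +-isAbelianGroup = record
      { isGroup = record
        { isMonoid = record
          { isSemigroup = record
            { isMagma = record { isEquivalence = isEquivalence ; ∙-cong = cong₂ _+q_ }
            ; assoc = λ x y z → cong₂ _+_iq (ℚP.+-assoc (req x) (req y) (req z)) (ℚP.+-assoc (imq x) (imq y) (imq z))
            }
          ; identity = comm∧idˡ⇒id +-comm λ x → cong₂ _+_iq (ℚP.+-identityˡ (req x)) (ℚP.+-identityˡ (imq x))
          }
        ; inverse = comm∧invˡ⇒inv +-comm λ x → cong₂ _+_iq (ℚP.+-inverseˡ (req x)) (ℚP.+-inverseˡ (imq x))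
        ; ⁻¹-cong = cong -q_
        }
      ; comm = +-comm
      }
    ; *-cong = cong₂ _*q_
    ; *-assoc = λ x y z → cong₂ _+_iq (*-assoc-re (req x) (imq x) (req y) (imq y) (req z) (imq z))
                                      (*-assoc-im (req x) (imq x) (req y) (imq y) (req z) (imq z))
    ; *-identity = comm∧idˡ⇒id *-comm λ x → cong₂ _+_iq (*-identityˡ-re (req x) (imq x)) (*-identityˡ-im (req x) (imq x))
    ; distrib = distribˡ , comm∧distrˡ⇒distrʳ *-comm distribˡ
    }
  ; *-comm = *-comm
  }
  where
  open ℚ[i]-laws
  +-comm : ∀ x y → x +q y ≡ y +q x
  +-comm x y = cong₂ _+_iq (ℚP.+-comm (req x) (req y)) (ℚP.+-comm (imq x) (imq y))
  *-comm : ∀ x y → x *q y ≡ y *q x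
  *-comm x y = cong₂ _+_iq (*-comm-re (req x) (imq x) (req y) (imq y)) (*-comm-im (req x) (imq x) (req y) (imq y))
  distribˡ : ∀ x y z → x *q (y +q z) ≡ x *q y +q x *q z
  distribˡ x y z = cong₂ _+_iq (distribˡ-re (req x) (imq x) (req y) (imq y) (req z) (imq z))
                              (distribˡ-im (req x) (imq x) (req y) (imq y) (req z) (imq z))

ℤ[i]-commutativeRing : CommutativeRing 0ℓ 0ℓ
ℤ[i]-commutativeRing = record { isCommutativeRing = ℤ[i]-isCommutativeRing }

ℚ[i]-commutativeRing : CommutativeRing 0ℓ 0ℓ
ℚ[i]-commutativeRing = record { isCommutativeRing = ℚ[i]-isCommutativeRing }

ℤ[i]-ring : ACR.AlmostCommutativeRing 0ℓ 0ℓ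
ℤ[i]-ring = ACR.fromCommutativeRing ℤ[i]-commutativeRing isZero
  where
  isZero : ∀ x → _
  isZero ((+ 0) + (+ 0) i) = just refl
  isZero _ = nothing

ℚ[i]-ring : ACR.AlmostCommutativeRing 0ℓ 0ℓ
ℚ[i]-ring = ACR.fromCommutativeRing ℚ[i]-commutativeRing isZero
  where
  isZero : ∀ x → _
  isZero (a + b iq) with 0ℚ ℚP.≟ a | 0ℚ ℚP.≟ b
  ... | yes a≡0 | yes b≡0 = just (cong₂ _+_iq a≡0 b≡0)
  ... | _ | _ = nothing

open CommutativeRing ℤ[i]-commutativeRing public
  using ()
  renaming ( *-assoc to *ᵍ-assoc; *-comm to *ᵍ-comm
           ; *-identityˡ to *ᵍ-identityˡ; *-identityʳ to *ᵍ-identityʳ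
           ; zeroˡ to *ᵍ-zeroˡ; distribˡ to *ᵍ-distribˡ-+ᵍ )

fromℤ : ℤ → ℚ
fromℤ z = z ℚ./ 1

fromℤ-mkℚ : ∀ z → fromℤ z ≡ mkℚ z 0 (Coprime.sym (Coprime.1-coprimeTo ℤ.∣ z ∣))
fromℤ-mkℚ z = ℚP.↥p/↧p≡p (mkℚ z 0 (Coprime.sym (Coprime.1-coprimeTo ℤ.∣ z ∣)))

fromℤ-injective : ∀ {x y} → fromℤ x ≡ fromℤ y → x ≡ y
fromℤ-injective {x} {y} eq rewrite fromℤ-mkℚ x | fromℤ-mkℚ y = cong ℚ.↥_ eq

fromℤ-homo-* : ∀ x y → fromℤ (x ℤ.* y) ≡ fromℤ x ℚ.* fromℤ y
fromℤ-homo-* x y rewrite fromℤ-mkℚ x | fromℤ-mkℚ y = refl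

fromℤ-homo-+ : ∀ x y → fromℤ (x ℤ.+ y) ≡ fromℤ x ℚ.+ fromℤ y
fromℤ-homo-+ x y rewrite fromℤ-mkℚ x | fromℤ-mkℚ y =
  cong₂ (λ a b → (a ℤ.+ b) ℚ./ 1) (sym (ℤP.*-identityʳ x)) (sym (ℤP.*-identityʳ y))

fromℤ-homo-neg : ∀ x → fromℤ (ℤ.- x) ≡ ℚ.- fromℤ x
fromℤ-homo-neg x rewrite fromℤ-mkℚ x | fromℤ-mkℚ (ℤ.- x) with x
... | + 0 = refl
... | + ℕ.suc n = refl
... | -[1+ n ] = refl

fromℤ-homo-det : ∀ a b c d → fromℤ (a ℤ.* d ℤ.- b ℤ.* c) ≡ fromℤ a ℚ.* fromℤ d ℚ.- fromℤ b ℚ.* fromℤ c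
fromℤ-homo-det a b c d = begin
  fromℤ (a ℤ.* d ℤ.- b ℤ.* c)                    ≡⟨ fromℤ-homo-+ (a ℤ.* d) (ℤ.- (b ℤ.* c)) ⟩
  fromℤ (a ℤ.* d) ℚ.+ fromℤ (ℤ.- (b ℤ.* c))      ≡⟨ cong₂ ℚ._+_ (fromℤ-homo-* a d) (fromℤ-homo-neg (b ℤ.* c)) ⟩
  fromℤ a ℚ.* fromℤ d ℚ.- fromℤ (b ℤ.* c)        ≡⟨ cong (λ z → fromℤ a ℚ.* fromℤ d ℚ.- z) (fromℤ-homo-* b c) ⟩
  fromℤ a ℚ.* fromℤ d ℚ.- fromℤ b ℚ.* fromℤ c    ∎
  where open ≡-Reasoning

ι-homo-+ : ∀ x y → ι (x +ᵍ y) ≡ ι x +q ι y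
ι-homo-+ x y = cong₂ _+_iq (fromℤ-homo-+ (re x) (re y)) (fromℤ-homo-+ (im x) (im y))

ι-homo-neg : ∀ x → ι (-ᵍ x) ≡ -q ι x
ι-homo-neg x = cong₂ _+_iq (fromℤ-homo-neg (re x)) (fromℤ-homo-neg (im x))

ι-homo-* : ∀ x y → ι (x *ᵍ y) ≡ ι x *q ι y
ι-homo-* (a + b i) (c + d i) = cong₂ _+_iq
  (fromℤ-homo-det a b d c)
  (trans (fromℤ-homo-+ (a ℤ.* d) (b ℤ.* c)) (cong₂ ℚ._+_ (fromℤ-homo-* a d) (fromℤ-homo-* b c)))

pattern +1ᵘ = inj₁ refl
pattern -1ᵘ = inj₂ (inj₁ refl)
pattern +iᵘ = inj₂ (inj₂ (inj₁ refl))
pattern -iᵘ = inj₂ (inj₂ (inj₂ refl))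

unit-inverse : ∀ {u} → IsUnit u → ∃[ v ] u *ᵍ v ≡ 1ᵍ
unit-inverse +1ᵘ = 1ᵍ , refl
unit-inverse -1ᵘ = -ᵍ 1ᵍ , refl
unit-inverse +iᵘ = -ᵍ iᵍ , refl
unit-inverse -iᵘ = iᵍ , refl

norm : ℤ[i] → ℕ.ℕ
norm (a + b i) = ℤ.∣ a ∣ ℕ.* ℤ.∣ a ∣ ℕ.+ ℤ.∣ b ∣ ℕ.* ℤ.∣ b ∣

private
  square≡∣∣² : ∀ a → a ℤ.* a ≡ + (ℤ.∣ a ∣ ℕ.* ℤ.∣ a ∣)
  square≡∣∣² a = trans (cong (ℤ._◃ (ℤ.∣ a ∣ ℕ.* ℤ.∣ a ∣)) (SignP.s*s≡+ (ℤ.sign a))) (ℤP.+◃n≡+n _)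

  norm≡ : ∀ z → + norm z ≡ re z ℤ.* re z ℤ.+ im z ℤ.* im z
  norm≡ (a + b i) = sym (cong₂ ℤ._+_ (square≡∣∣² a) (square≡∣∣² b))

  two-squares : ∀ a b c d → (a ℤ.* a ℤ.+ b ℤ.* b) ℤ.* (c ℤ.* c ℤ.+ d ℤ.* d) ≡
    (a ℤ.* c ℤ.- b ℤ.* d) ℤ.* (a ℤ.* c ℤ.- b ℤ.* d) ℤ.+ (a ℤ.* d ℤ.+ b ℤ.* c) ℤ.* (a ℤ.* d ℤ.+ b ℤ.* c)
  two-squares = solve-∀

norm-homo-* : ∀ u v → norm (u *ᵍ v) ≡ norm u ℕ.* norm v
norm-homo-* u@(a + b i) v@(c + d i) = ℤP.+-injective (begin
  + norm (u *ᵍ v)                                     ≡⟨ norm≡ (u *ᵍ v) ⟩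
  (a ℤ.* c ℤ.- b ℤ.* d) ℤ.* (a ℤ.* c ℤ.- b ℤ.* d) ℤ.+
  (a ℤ.* d ℤ.+ b ℤ.* c) ℤ.* (a ℤ.* d ℤ.+ b ℤ.* c)     ≡⟨ two-squares a b c d ⟨
  (a ℤ.* a ℤ.+ b ℤ.* b) ℤ.* (c ℤ.* c ℤ.+ d ℤ.* d)     ≡⟨ cong₂ ℤ._*_ (norm≡ u) (norm≡ v) ⟨
  + norm u ℤ.* + norm v                               ≡⟨ ℤP.pos-* (norm u) (norm v) ⟨
  + (norm u ℕ.* norm v)                               ∎)
  where open ≡-Reasoning

norm≡1⇒unit : ∀ u → norm u ≡ 1 → IsUnit u
norm≡1⇒unit ((+ 0) + (+ 0) i) ()
norm≡1⇒unit ((+ 0) + (+ 1) i) refl = +iᵘ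
norm≡1⇒unit ((+ 0) + (+ ℕ.suc (ℕ.suc k)) i) ()
norm≡1⇒unit ((+ 0) + (-[1+ 0 ]) i) refl = -iᵘ
norm≡1⇒unit ((+ 0) + (-[1+ ℕ.suc k ]) i) ()
norm≡1⇒unit ((+ 1) + (+ 0) i) refl = +1ᵘ
norm≡1⇒unit ((+ 1) + (+ ℕ.suc k) i) ()
norm≡1⇒unit ((+ 1) + (-[1+ k ]) i) ()
norm≡1⇒unit ((+ ℕ.suc (ℕ.suc j)) + b i) ()
norm≡1⇒unit ((-[1+ 0 ]) + (+ 0) i) refl = -1ᵘ
norm≡1⇒unit ((-[1+ 0 ]) + (+ ℕ.suc k) i) ()
norm≡1⇒unit ((-[1+ 0 ]) + (-[1+ k ]) i) ()
norm≡1⇒unit ((-[1+ ℕ.suc j ]) + b i) ()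

*≡1⇒unit : ∀ u v → u *ᵍ v ≡ 1ᵍ → IsUnit u
*≡1⇒unit u v uv≡1 = norm≡1⇒unit u (ℕP.m*n≡1⇒m≡1 (norm u) (norm v) (trans (sym (norm-homo-* u v)) (cong norm uv≡1)))

unit-* : ∀ {u v} → IsUnit u → IsUnit v → IsUnit (u *ᵍ v)
unit-* {u} {v} uᵘ vᵘ with unit-inverse uᵘ | unit-inverse vᵘ
... | u' , uu'≡1 | v' , vv'≡1 = *≡1⇒unit (u *ᵍ v) (u' *ᵍ v')
  (trans (interchange u v u' v') (cong₂ _*ᵍ_ uu'≡1 vv'≡1))
  where
  interchange : ∀ u v u' v' → (u *ᵍ v) *ᵍ (u' *ᵍ v') ≡ (u *ᵍ u') *ᵍ (v *ᵍ v')
  interchange = solve-∀-in ℤ[i]-ring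

det₂ : V → V → ℤ[i]
det₂ a b = fst a *ᵍ snd b -ᵍ fst b *ᵍ snd a

·ᵛ-assoc : ∀ x y v → (x *ᵍ y) ·ᵛ v ≡ x ·ᵛ (y ·ᵛ v)
·ᵛ-assoc x y ⟨ v₁ , v₂ ⟩ = cong₂ ⟨_,_⟩ (*ᵍ-assoc x y v₁) (*ᵍ-assoc x y v₂)

·ᵛ-identity : ∀ v → 1ᵍ ·ᵛ v ≡ v
·ᵛ-identity ⟨ v₁ , v₂ ⟩ = cong₂ ⟨_,_⟩ (*ᵍ-identityˡ v₁) (*ᵍ-identityˡ v₂)

·ᵛ-distrib : ∀ c u w → c ·ᵛ (u +ᵛ w) ≡ c ·ᵛ u +ᵛ c ·ᵛ w
·ᵛ-distrib c ⟨ u₁ , u₂ ⟩ ⟨ w₁ , w₂ ⟩ = cong₂ ⟨_,_⟩ (*ᵍ-distribˡ-+ᵍ c u₁ w₁) (*ᵍ-distribˡ-+ᵍ c u₂ w₂)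

·ᵛ-combination : ∀ c x y a b → c ·ᵛ (x ·ᵛ a +ᵛ y ·ᵛ b) ≡ x ·ᵛ (c ·ᵛ a) +ᵛ y ·ᵛ (c ·ᵛ b)
·ᵛ-combination c x y ⟨ a₁ , a₂ ⟩ ⟨ b₁ , b₂ ⟩ = cong₂ ⟨_,_⟩ (expanded c x y a₁ b₁) (expanded c x y a₂ b₂)
  where
  expanded : ∀ c x y a b → c *ᵍ (x *ᵍ a +ᵍ y *ᵍ b) ≡ x *ᵍ (c *ᵍ a) +ᵍ y *ᵍ (c *ᵍ b)
  expanded = solve-∀-in ℤ[i]-ring

cramer : ∀ a b v → det₂ v b ·ᵛ a +ᵛ det₂ a v ·ᵛ b ≡ det₂ a b ·ᵛ v
cramer ⟨ a₁ , a₂ ⟩ ⟨ b₁ , b₂ ⟩ ⟨ v₁ , v₂ ⟩ =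
  cong₂ ⟨_,_⟩ (expanded₁ a₁ a₂ b₁ b₂ v₁ v₂) (expanded₂ a₁ a₂ b₁ b₂ v₁ v₂)
  where
  expanded₁ : ∀ a₁ a₂ b₁ b₂ v₁ v₂ →
    (v₁ *ᵍ b₂ -ᵍ b₁ *ᵍ v₂) *ᵍ a₁ +ᵍ (a₁ *ᵍ v₂ -ᵍ v₁ *ᵍ a₂) *ᵍ b₁ ≡ (a₁ *ᵍ b₂ -ᵍ b₁ *ᵍ a₂) *ᵍ v₁
  expanded₁ = solve-∀-in ℤ[i]-ring
  expanded₂ : ∀ a₁ a₂ b₁ b₂ v₁ v₂ →
    (v₁ *ᵍ b₂ -ᵍ b₁ *ᵍ v₂) *ᵍ a₂ +ᵍ (a₁ *ᵍ v₂ -ᵍ v₁ *ᵍ a₂) *ᵍ b₂ ≡ (a₁ *ᵍ b₂ -ᵍ b₁ *ᵍ a₂) *ᵍ v₂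
  expanded₂ = solve-∀-in ℤ[i]-ring

det₂-linearˡ : ∀ x y a b → det₂ (x ·ᵛ a +ᵛ y ·ᵛ b) b ≡ x *ᵍ det₂ a b
det₂-linearˡ x y ⟨ a₁ , a₂ ⟩ ⟨ b₁ , b₂ ⟩ = expanded a₁ a₂ b₁ b₂ x y
  where
  expanded : ∀ a₁ a₂ b₁ b₂ x y →
    (x *ᵍ a₁ +ᵍ y *ᵍ b₁) *ᵍ b₂ -ᵍ b₁ *ᵍ (x *ᵍ a₂ +ᵍ y *ᵍ b₂) ≡ x *ᵍ (a₁ *ᵍ b₂ -ᵍ b₁ *ᵍ a₂)
  expanded = solve-∀-in ℤ[i]-ring

det₂-linearʳ : ∀ x y a b → det₂ a (x ·ᵛ a +ᵛ y ·ᵛ b) ≡ y *ᵍ det₂ a b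
det₂-linearʳ x y ⟨ a₁ , a₂ ⟩ ⟨ b₁ , b₂ ⟩ = expanded a₁ a₂ b₁ b₂ x y
  where
  expanded : ∀ a₁ a₂ b₁ b₂ x y →
    a₁ *ᵍ (x *ᵍ a₂ +ᵍ y *ᵍ b₂) -ᵍ (x *ᵍ a₁ +ᵍ y *ᵍ b₁) *ᵍ a₂ ≡ y *ᵍ (a₁ *ᵍ b₂ -ᵍ b₁ *ᵍ a₂)
  expanded = solve-∀-in ℤ[i]-ring

det₂-zeroˡ : ∀ b → det₂ 0ᵛ b ≡ 0ᵍ
det₂-zeroˡ ⟨ b₁ , b₂ ⟩ = expanded b₁ b₂
  where
  expanded : ∀ b₁ b₂ → 0ᵍ *ᵍ b₂ -ᵍ b₁ *ᵍ 0ᵍ ≡ 0ᵍ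
  expanded = solve-∀-in ℤ[i]-ring

det₂-zeroʳ : ∀ a → det₂ a 0ᵛ ≡ 0ᵍ
det₂-zeroʳ ⟨ a₁ , a₂ ⟩ = expanded a₁ a₂
  where
  expanded : ∀ a₁ a₂ → a₁ *ᵍ 0ᵍ -ᵍ 0ᵍ *ᵍ a₂ ≡ 0ᵍ
  expanded = solve-∀-in ℤ[i]-ring

det₂-multiplicative : ∀ x₁ y₁ x₂ y₂ a b →
  det₂ (x₁ ·ᵛ a +ᵛ y₁ ·ᵛ b) (x₂ ·ᵛ a +ᵛ y₂ ·ᵛ b) ≡ det₂ ⟨ x₁ , y₁ ⟩ ⟨ x₂ , y₂ ⟩ *ᵍ det₂ a b
det₂-multiplicative x₁ y₁ x₂ y₂ ⟨ a₁ , a₂ ⟩ ⟨ b₁ , b₂ ⟩ = expanded a₁ a₂ b₁ b₂ x₁ y₁ x₂ y₂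
  where
  expanded : ∀ a₁ a₂ b₁ b₂ x₁ y₁ x₂ y₂ →
    (x₁ *ᵍ a₁ +ᵍ y₁ *ᵍ b₁) *ᵍ (x₂ *ᵍ a₂ +ᵍ y₂ *ᵍ b₂) -ᵍ (x₂ *ᵍ a₁ +ᵍ y₂ *ᵍ b₁) *ᵍ (x₁ *ᵍ a₂ +ᵍ y₁ *ᵍ b₂)
      ≡ (x₁ *ᵍ y₂ -ᵍ x₂ *ᵍ y₁) *ᵍ (a₁ *ᵍ b₂ -ᵍ b₁ *ᵍ a₂)
  expanded = solve-∀-in ℤ[i]-ring

unit-cancel : ∀ {u} x → IsUnit u → x *ᵍ u ≡ 0ᵍ → x ≡ 0ᵍ
unit-cancel {u} x uᵘ xu≡0 with unit-inverse uᵘ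
... | e , ue≡1 = begin
  x                 ≡⟨ *ᵍ-identityʳ x ⟨
  x *ᵍ 1ᵍ           ≡⟨ cong (x *ᵍ_) ue≡1 ⟨
  x *ᵍ (u *ᵍ e)     ≡⟨ *ᵍ-assoc x u e ⟨
  (x *ᵍ u) *ᵍ e     ≡⟨ cong (_*ᵍ e) xu≡0 ⟩
  0ᵍ *ᵍ e           ≡⟨ *ᵍ-zeroˡ e ⟩
  0ᵍ                ∎
  where open ≡-Reasoning

columns-isBasis : ∀ (M : GL₂) → IsBasis (proj₁ (cols M)) (proj₂ (cols M))
columns-isBasis (mat p q r s , δᵘ) with unit-inverse δᵘ
... | e , δe≡1 = span , independent
  where
  a b : V
  a = ⟨ p , r ⟩
  b = ⟨ q , s ⟩
  open ≡-Reasoning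
  span : ∀ v → ∃[ x ] ∃[ y ] (v ≡ x ·ᵛ a +ᵛ y ·ᵛ b)
  span v = e *ᵍ det₂ v b , e *ᵍ det₂ a v , sym (begin
    (e *ᵍ det₂ v b) ·ᵛ a +ᵛ (e *ᵍ det₂ a v) ·ᵛ b   ≡⟨ cong₂ _+ᵛ_ (·ᵛ-assoc e _ a) (·ᵛ-assoc e _ b) ⟩
    e ·ᵛ (det₂ v b ·ᵛ a) +ᵛ e ·ᵛ (det₂ a v ·ᵛ b)   ≡⟨ ·ᵛ-distrib e _ _ ⟨
    e ·ᵛ (det₂ v b ·ᵛ a +ᵛ det₂ a v ·ᵛ b)          ≡⟨ cong (e ·ᵛ_) (cramer a b v) ⟩
    e ·ᵛ (det₂ a b ·ᵛ v)                            ≡⟨ ·ᵛ-assoc e _ v ⟨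
    (e *ᵍ det₂ a b) ·ᵛ v                            ≡⟨ cong (_·ᵛ v) (trans (*ᵍ-comm e _) δe≡1) ⟩
    1ᵍ ·ᵛ v                                         ≡⟨ ·ᵛ-identity v ⟩
    v                                               ∎)
  independent : ∀ x y → x ·ᵛ a +ᵛ y ·ᵛ b ≡ 0ᵛ → (x ≡ 0ᵍ) × (y ≡ 0ᵍ)
  independent x y xa+yb≡0 =
      unit-cancel x δᵘ (trans (sym (det₂-linearˡ x y a b)) (trans (cong (λ v → det₂ v b) xa+yb≡0) (det₂-zeroˡ b)))
    , unit-cancel y δᵘ (trans (sym (det₂-linearʳ x y a b)) (trans (cong (det₂ a) xa+yb≡0) (det₂-zeroʳ a)))

basis⇒unit-det₂ : ∀ {a b} → IsBasis a b → IsUnit (det₂ a b)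
basis⇒unit-det₂ {a} {b} (span , _) with span ⟨ 1ᵍ , 0ᵍ ⟩ | span ⟨ 0ᵍ , 1ᵍ ⟩
... | x₁ , y₁ , e₁≡ | x₂ , y₂ , e₂≡ =
  *≡1⇒unit (det₂ a b) (det₂ ⟨ x₁ , y₁ ⟩ ⟨ x₂ , y₂ ⟩) (begin
    det₂ a b *ᵍ det₂ ⟨ x₁ , y₁ ⟩ ⟨ x₂ , y₂ ⟩                     ≡⟨ *ᵍ-comm (det₂ a b) _ ⟩
    det₂ ⟨ x₁ , y₁ ⟩ ⟨ x₂ , y₂ ⟩ *ᵍ det₂ a b                     ≡⟨ det₂-multiplicative x₁ y₁ x₂ y₂ a b ⟨
    det₂ (x₁ ·ᵛ a +ᵛ y₁ ·ᵛ b) (x₂ ·ᵛ a +ᵛ y₂ ·ᵛ b)               ≡⟨ cong₂ det₂ e₁≡ e₂≡ ⟨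
    det₂ ⟨ 1ᵍ , 0ᵍ ⟩ ⟨ 0ᵍ , 1ᵍ ⟩                                 ≡⟨⟩
    1ᵍ                                                           ∎)
  where open ≡-Reasoning

real : ℤ → ℤ[i]
real n = n + (+ 0) i

real-det : ∀ p q r s → real (p ℤ.* s ℤ.- q ℤ.* r) ≡ real p *ᵍ real s -ᵍ real q *ᵍ real r
real-det p q r s = cong₂ _+_i (real-part p q r s) (imaginary-part p q r s)
  where
  real-part : ∀ p q r s → p ℤ.* s ℤ.- q ℤ.* r ≡ p ℤ.* s ℤ.- + 0 ℤ.* + 0 ℤ.- (q ℤ.* r ℤ.- + 0 ℤ.* + 0)
  real-part = solve-∀
  imaginary-part : ∀ p q r s → + 0 ≡ p ℤ.* + 0 ℤ.+ + 0 ℤ.* s ℤ.+ ℤ.- (q ℤ.* + 0 ℤ.+ + 0 ℤ.* r)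
  imaginary-part = solve-∀

sameOriented-refl : ∀ a b → SameOrientedLattice (a , b) (a , b)
sameOriented-refl ⟨ a₁ , a₂ ⟩ ⟨ b₁ , b₂ ⟩ =
  + 1 , + 0 , + 0 , + 1 ,
  cong₂ ⟨_,_⟩ (first a₁ b₁) (first a₂ b₂) , cong₂ ⟨_,_⟩ (second a₁ b₁) (second a₂ b₂) , refl
  where
  first : ∀ u v → u ≡ 1ᵍ *ᵍ u +ᵍ 0ᵍ *ᵍ v
  first = solve-∀-in ℤ[i]-ring
  second : ∀ u v → v ≡ 0ᵍ *ᵍ u +ᵍ 1ᵍ *ᵍ v
  second = solve-∀-in ℤ[i]-ring

sameOriented-sym : ∀ {a b a' b'} → SameOrientedLattice (a , b) (a' , b') → SameOrientedLattice (a' , b') (a , b)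
sameOriented-sym {⟨ a₁ , a₂ ⟩} {⟨ b₁ , b₂ ⟩} (p , q , r , s , refl , refl , det≡1) =
  s , ℤ.- q , ℤ.- r , p ,
  cong₂ ⟨_,_⟩ (undo₁ a₁ b₁) (undo₁ a₂ b₂) , cong₂ ⟨_,_⟩ (undo₂ a₁ b₁) (undo₂ a₂ b₂) ,
  trans (adjugate-det p q r s) det≡1
  where
  P = real p
  Q = real q
  R = real r
  S = real s
  det≡1ᵍ : P *ᵍ S -ᵍ Q *ᵍ R ≡ 1ᵍ
  det≡1ᵍ = trans (sym (real-det p q r s)) (cong real det≡1)
  adjugate-det : ∀ p q r s → s ℤ.* p ℤ.- (ℤ.- q) ℤ.* (ℤ.- r) ≡ p ℤ.* s ℤ.- q ℤ.* r
  adjugate-det = solve-∀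
  adjugate₁ : ∀ P Q R S u v → S *ᵍ (P *ᵍ u +ᵍ Q *ᵍ v) +ᵍ (-ᵍ Q) *ᵍ (R *ᵍ u +ᵍ S *ᵍ v) ≡ (P *ᵍ S -ᵍ Q *ᵍ R) *ᵍ u
  adjugate₁ = solve-∀-in ℤ[i]-ring
  adjugate₂ : ∀ P Q R S u v → (-ᵍ R) *ᵍ (P *ᵍ u +ᵍ Q *ᵍ v) +ᵍ P *ᵍ (R *ᵍ u +ᵍ S *ᵍ v) ≡ (P *ᵍ S -ᵍ Q *ᵍ R) *ᵍ v
  adjugate₂ = solve-∀-in ℤ[i]-ring
  undo₁ : ∀ u v → u ≡ S *ᵍ (P *ᵍ u +ᵍ Q *ᵍ v) +ᵍ (-ᵍ Q) *ᵍ (R *ᵍ u +ᵍ S *ᵍ v)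
  undo₁ u v = sym (trans (adjugate₁ P Q R S u v) (trans (cong (_*ᵍ u) det≡1ᵍ) (*ᵍ-identityˡ u)))
  undo₂ : ∀ u v → v ≡ (-ᵍ R) *ᵍ (P *ᵍ u +ᵍ Q *ᵍ v) +ᵍ P *ᵍ (R *ᵍ u +ᵍ S *ᵍ v)
  undo₂ u v = sym (trans (adjugate₂ P Q R S u v) (trans (cong (_*ᵍ v) det≡1ᵍ) (*ᵍ-identityˡ v)))

sameOriented-scale : ∀ c {a b a' b'} → SameOrientedLattice (a , b) (a' , b') →
                     SameOrientedLattice (c ·ᵛ a , c ·ᵛ b) (c ·ᵛ a' , c ·ᵛ b')
sameOriented-scale c {a} {b} (p , q , r , s , refl , refl , det≡1) =
  p , q , r , s , ·ᵛ-combination c (real p) (real q) a b , ·ᵛ-combination c (real r) (real s) a b , det≡1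

sameOriented-negate : ∀ {a b a' b'} → SameOrientedLattice (a , b) (a' , b') →
                      SameOrientedLattice (a , b) ((-ᵍ 1ᵍ) ·ᵛ a' , (-ᵍ 1ᵍ) ·ᵛ b')
sameOriented-negate {⟨ a₁ , a₂ ⟩} {⟨ b₁ , b₂ ⟩} (p , q , r , s , refl , refl , det≡1) =
  ℤ.- p , ℤ.- q , ℤ.- r , ℤ.- s ,
  cong₂ ⟨_,_⟩ (negate (real p) (real q) a₁ b₁) (negate (real p) (real q) a₂ b₂) ,
  cong₂ ⟨_,_⟩ (negate (real r) (real s) a₁ b₁) (negate (real r) (real s) a₂ b₂) ,
  trans (negated-det p q r s) det≡1
  where
  negate : ∀ x y a b → (-ᵍ 1ᵍ) *ᵍ (x *ᵍ a +ᵍ y *ᵍ b) ≡ (-ᵍ x) *ᵍ a +ᵍ (-ᵍ y) *ᵍ b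
  negate = solve-∀-in ℤ[i]-ring
  negated-det : ∀ p q r s → (ℤ.- p) ℤ.* (ℤ.- s) ℤ.- (ℤ.- q) ℤ.* (ℤ.- r) ≡ p ℤ.* s ℤ.- q ℤ.* r
  negated-det = solve-∀

sameLax-refl : ∀ a b → SameLaxLattice (a , b) (a , b)
sameLax-refl a b = inj₁ (sameOriented-refl a b , sameOriented-refl (iᵍ ·ᵛ a) (iᵍ ·ᵛ b))

sameLax-sym : ∀ {a b a' b'} → SameLaxLattice (a , b) (a' , b') → SameLaxLattice (a' , b') (a , b)
sameLax-sym (inj₁ (L≈L' , iL≈iL')) = inj₁ (sameOriented-sym L≈L' , sameOriented-sym iL≈iL')
sameLax-sym (inj₂ (L≈iL' , iL≈L')) = inj₂ (sameOriented-sym iL≈L' , sameOriented-sym L≈iL')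

sameLax-unit : ∀ {u a b a' b'} → IsUnit u → SameOrientedLattice (a , b) (a' , b') →
               SameLaxLattice (a , b) (u ·ᵛ a' , u ·ᵛ b')
sameLax-unit {a' = a'} {b'} +1ᵘ L≈L' = inj₁ (L≈1L' , sameOriented-scale iᵍ L≈1L')
  where
  L≈1L' = subst₂ (λ x y → SameOrientedLattice _ (x , y)) (sym (·ᵛ-identity a')) (sym (·ᵛ-identity b')) L≈L'
sameLax-unit -1ᵘ L≈L' = inj₁ (sameOriented-negate L≈L' , sameOriented-scale iᵍ (sameOriented-negate L≈L'))
sameLax-unit {a' = a'} {b'} +iᵘ L≈L' =
  inj₂ ( subst₂ (λ x y → SameOrientedLattice _ (x , y)) (·ᵛ-assoc iᵍ iᵍ a') (·ᵛ-assoc iᵍ iᵍ b') (sameOriented-negate L≈L')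
       , sameOriented-scale iᵍ L≈L')
sameLax-unit {a' = a'} {b'} -iᵘ L≈L' =
  inj₂ ( subst₂ (λ x y → SameOrientedLattice _ (x , y)) (trans (sym (·ᵛ-identity a')) (·ᵛ-assoc iᵍ (-ᵍ iᵍ) a'))
                                                         (trans (sym (·ᵛ-identity b')) (·ᵛ-assoc iᵍ (-ᵍ iᵍ) b')) L≈L'
       , subst₂ (λ x y → SameOrientedLattice _ (x , y)) (sym (·ᵛ-assoc (-ᵍ 1ᵍ) iᵍ a')) (sym (·ᵛ-assoc (-ᵍ 1ᵍ) iᵍ b'))
           (sameOriented-negate (sameOriented-scale iᵍ L≈L')))

-- The cyclic order of ℚ∞

-- v ≐ s : v lies on the line of ℚ² that s ∈ ℚ∞ = P¹(ℚ) stands for; the zero vector lies on every line.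
infix 4 _≐_
_≐_ : ℚ × ℚ → ℚ∞ → Set
(x , y) ≐ nothing = y ≡ 0ℚ
(x , y) ≐ just τ  = x ≡ τ ℚ.* y

pos*pos : ∀ {x y} → 0ℚ < x → 0ℚ < y → 0ℚ < x ℚ.* y
pos*pos {x} {y} 0<x 0<y = ℚP.positive⁻¹ _ {{ℚP.pos*pos⇒pos x {{ℚ.positive 0<x}} y {{ℚ.positive 0<y}}}}

neg*neg : ∀ {x y} → x < 0ℚ → y < 0ℚ → 0ℚ < x ℚ.* y
neg*neg {x} {y} x<0 y<0 = ℚP.positive⁻¹ _ {{ℚP.neg*neg⇒pos x {{ℚ.negative x<0}} y {{ℚ.negative y<0}}}}

pos*neg : ∀ {x y} → 0ℚ < x → y < 0ℚ → x ℚ.* y < 0ℚ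
pos*neg {x} {y} 0<x y<0 = ℚP.negative⁻¹ _ {{ℚP.pos*neg⇒neg x {{ℚ.positive 0<x}} y {{ℚ.negative y<0}}}}

neg*pos : ∀ {x y} → x < 0ℚ → 0ℚ < y → x ℚ.* y < 0ℚ
neg*pos {x} {y} x<0 0<y = ℚP.negative⁻¹ _ {{ℚP.neg*pos⇒neg x {{ℚ.negative x<0}} y {{ℚ.positive 0<y}}}}

square-pos : ∀ {y} → y ≢ 0ℚ → 0ℚ < y ℚ.* y
square-pos {y} y≢0 with ℚP.<-cmp y 0ℚ
... | tri< y<0 _ _ = neg*neg y<0 y<0
... | tri≈ _ y≡0 _ = contradiction y≡0 y≢0
... | tri> _ _ 0<y = pos*pos 0<y 0<y

pos⇔pos-*-square : ∀ x y {z} → y ≢ 0ℚ → x ℚ.* (y ℚ.* y) ≡ z → (0ℚ < x ⇔ 0ℚ < z)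
pos⇔pos-*-square x y y≢0 refl = mk⇔
  (λ 0<x → pos*pos 0<x (square-pos y≢0))
  (λ 0<z → ℚP.*-cancelʳ-<-nonNeg (y ℚ.* y) {{ℚ.nonNegative (ℚP.<⇒≤ (square-pos y≢0))}}
             (subst (_< x ℚ.* (y ℚ.* y)) (sym (ℚP.*-zeroˡ (y ℚ.* y))) 0<z))

*≡0⇒≡0 : ∀ {x y} → x ≢ 0ℚ → x ℚ.* y ≡ 0ℚ → y ≡ 0ℚ
*≡0⇒≡0 {x} {y} x≢0 xy≡0 = begin
  y                         ≡⟨ ℚP.*-identityˡ y ⟨
  1ℚ ℚ.* y                  ≡⟨ cong (ℚ._* y) (ℚP.*-inverseˡ x) ⟨
  (ℚ.1/ x) ℚ.* x ℚ.* y      ≡⟨ ℚP.*-assoc (ℚ.1/ x) x y ⟩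
  (ℚ.1/ x) ℚ.* (x ℚ.* y)    ≡⟨ cong ((ℚ.1/ x) ℚ.*_) xy≡0 ⟩
  (ℚ.1/ x) ℚ.* 0ℚ           ≡⟨ ℚP.*-zeroʳ (ℚ.1/ x) ⟩
  0ℚ                        ∎
  where
  open ≡-Reasoning
  instance
    _ : ℚ.NonZero x
    _ = ℚ.≢-nonZero x≢0

<⇒0<- : ∀ {x y} → x < y → 0ℚ < y ℚ.- x
<⇒0<- {x} {y} x<y = subst (_< y ℚ.- x) (ℚP.+-inverseʳ x) (ℚP.+-monoˡ-< (ℚ.- x) x<y)

0<-⇒< : ∀ {x y} → 0ℚ < y ℚ.- x → x < y
0<-⇒< {x} {y} 0<y-x = subst₂ _<_ (ℚP.+-identityˡ x) (minus-plus y x) (ℚP.+-monoˡ-< x 0<y-x)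
  where
  minus-plus : ∀ y x → (y ℚ.- x) ℚ.+ x ≡ y
  minus-plus = solve-∀-in ℚ-ring

<⇒-<0 : ∀ {x y} → x < y → x ℚ.- y < 0ℚ
<⇒-<0 {x} {y} x<y = subst (x ℚ.- y <_) (ℚP.+-inverseʳ y) (ℚP.+-monoˡ-< (ℚ.- y) x<y)

-<0⇒< : ∀ {x y} → x ℚ.- y < 0ℚ → x < y
-<0⇒< {x} {y} x-y<0 = subst₂ _<_ (minus-plus x y) (ℚP.+-identityˡ y) (ℚP.+-monoˡ-< y x-y<0)
  where
  minus-plus : ∀ x y → (x ℚ.- y) ℚ.+ y ≡ x
  minus-plus = solve-∀-in ℚ-ring

<⇔0<- : ∀ {x y} → x < y ⇔ 0ℚ < y ℚ.- x
<⇔0<- = mk⇔ <⇒0<- 0<-⇒<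

cyclic⇔ : ∀ t₀ t₁ t∞ → Cyclic (just t₀) (just t₁) (just t∞) ⇔ 0ℚ < (t₁ ℚ.- t₀) ℚ.* (t∞ ℚ.- t₁) ℚ.* (t∞ ℚ.- t₀)
cyclic⇔ t₀ t₁ t∞ = mk⇔ cyclic⇒ ⇒cyclic
  where
  X = t₁ ℚ.- t₀
  Y = t∞ ℚ.- t₁
  W = t∞ ℚ.- t₀
  cyclic⇒ : Cyclic (just t₀) (just t₁) (just t∞) → 0ℚ < X ℚ.* Y ℚ.* W
  cyclic⇒ (inj₁ (t₀<t₁ , t₁<t∞)) =
    pos*pos (pos*pos (<⇒0<- t₀<t₁) (<⇒0<- t₁<t∞)) (<⇒0<- (ℚP.<-trans t₀<t₁ t₁<t∞))
  cyclic⇒ (inj₂ (inj₁ (t₁<t∞ , t∞<t₀))) =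
    neg*neg (neg*pos (<⇒-<0 (ℚP.<-trans t₁<t∞ t∞<t₀)) (<⇒0<- t₁<t∞)) (<⇒-<0 t∞<t₀)
  cyclic⇒ (inj₂ (inj₂ (t∞<t₀ , t₀<t₁))) =
    neg*neg (pos*neg (<⇒0<- t₀<t₁) (<⇒-<0 (ℚP.<-trans t∞<t₀ t₀<t₁))) (<⇒-<0 t∞<t₀)
  vanishes : ∀ {x y w} → x ≡ 0ℚ ⊎ y ≡ 0ℚ ⊎ w ≡ 0ℚ → ¬ 0ℚ < x ℚ.* y ℚ.* w
  vanishes {x} {y} {w} (inj₁ refl) = ℚP.<-irrefl (sym (trans (cong (ℚ._* w) (ℚP.*-zeroˡ y)) (ℚP.*-zeroˡ w)))
  vanishes {x} {y} {w} (inj₂ (inj₁ refl)) = ℚP.<-irrefl (sym (trans (cong (ℚ._* w) (ℚP.*-zeroʳ x)) (ℚP.*-zeroˡ w)))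
  vanishes {x} {y} {w} (inj₂ (inj₂ refl)) = ℚP.<-irrefl (sym (ℚP.*-zeroʳ (x ℚ.* y)))
  ⇒cyclic : 0ℚ < X ℚ.* Y ℚ.* W → Cyclic (just t₀) (just t₁) (just t∞)
  ⇒cyclic pos with ℚP.<-cmp X 0ℚ | ℚP.<-cmp Y 0ℚ | ℚP.<-cmp W 0ℚ
  ... | tri≈ _ X≡0 _ | _ | _ = contradiction pos (vanishes {X} {Y} {W} (inj₁ X≡0))
  ... | _ | tri≈ _ Y≡0 _ | _ = contradiction pos (vanishes {X} {Y} {W} (inj₂ (inj₁ Y≡0)))
  ... | _ | _ | tri≈ _ W≡0 _ = contradiction pos (vanishes {X} {Y} {W} (inj₂ (inj₂ W≡0)))
  ... | tri> _ _ 0<X | tri> _ _ 0<Y | _ = inj₁ (0<-⇒< 0<X , 0<-⇒< 0<Y)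
  ... | tri< X<0 _ _ | tri> _ _ 0<Y | tri< W<0 _ _ = inj₂ (inj₁ (0<-⇒< 0<Y , -<0⇒< W<0))
  ... | tri> _ _ 0<X | tri< Y<0 _ _ | tri< W<0 _ _ = inj₂ (inj₂ (-<0⇒< W<0 , 0<-⇒< 0<X))
  ... | tri< X<0 _ _ | tri> _ _ 0<Y | tri> _ _ 0<W = ⊥-elim (ℚP.<-asym pos (neg*pos (neg*pos X<0 0<Y) 0<W))
  ... | tri> _ _ 0<X | tri< Y<0 _ _ | tri> _ _ 0<W = ⊥-elim (ℚP.<-asym pos (neg*pos (pos*neg 0<X Y<0) 0<W))
  ... | tri< X<0 _ _ | tri< Y<0 _ _ | _ =
    ⊥-elim (ℚP.<-asym pos (pos*neg (neg*neg X<0 Y<0) (<⇒-<0 (ℚP.<-trans (-<0⇒< {t∞} Y<0) (-<0⇒< {t₁} X<0)))))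

cyclic-∞⇔ : ∀ t₀ t₁ → Cyclic (just t₀) (just t₁) nothing ⇔ t₀ < t₁
cyclic-∞⇔ t₀ t₁ = mk⇔ (λ { (inj₁ (t₀<t₁ , _)) → t₀<t₁ ; (inj₂ (inj₁ (_ , ()))) ; (inj₂ (inj₂ (() , _))) })
                      (λ t₀<t₁ → inj₁ (t₀<t₁ , tt))

∞-cyclic⇔ : ∀ t₁ t∞ → Cyclic nothing (just t₁) (just t∞) ⇔ t₁ < t∞
∞-cyclic⇔ t₁ t∞ = mk⇔ (λ { (inj₁ (() , _)) ; (inj₂ (inj₁ (t₁<t∞ , _))) → t₁<t∞ ; (inj₂ (inj₂ (_ , ()))) })
                      (λ t₁<t∞ → inj₂ (inj₁ (t₁<t∞ , tt)))

cyclic∞⇔ : ∀ t₀ t∞ → Cyclic (just t₀) nothing (just t∞) ⇔ t∞ < t₀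
cyclic∞⇔ t₀ t∞ = mk⇔ (λ { (inj₁ (_ , ())) ; (inj₂ (inj₁ (() , _))) ; (inj₂ (inj₂ (t∞<t₀ , _))) → t∞<t₀ })
                     (λ t∞<t₀ → inj₂ (inj₂ (t∞<t₀ , tt)))

*-square≢0 : ∀ x y {z} → x ℚ.* (y ℚ.* y) ≡ z → z ≢ 0ℚ → y ≢ 0ℚ
*-square≢0 x y refl z≢0 refl = z≢0 (ℚP.*-zeroʳ x)

private
  det-vanishes : ∀ a b {c d} → c ≡ 0ℚ → d ≡ 0ℚ → a ℚ.* d ℚ.- b ℚ.* c ≡ 0ℚ
  det-vanishes a b refl refl = vanishing a b
    where
    vanishing : ∀ a b → a ℚ.* 0ℚ ℚ.- b ℚ.* 0ℚ ≡ 0ℚ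
    vanishing = solve-∀-in ℚ-ring

  module DifferenceRelations t₀ t₁ t∞ c d (h₁ : t∞ ℚ.* c ℚ.+ t₀ ℚ.* d ≡ t₁ ℚ.* (c ℚ.+ d)) where
    open ≡-Reasoning
    D = t∞ ℚ.* c ℚ.* d ℚ.- t₀ ℚ.* d ℚ.* c

    X-rel : (t₁ ℚ.- t₀) ℚ.* (d ℚ.* (c ℚ.+ d)) ≡ D
    X-rel = begin
      (t₁ ℚ.- t₀) ℚ.* (d ℚ.* (c ℚ.+ d))                  ≡⟨ expand t₀ t₁ c d ⟩
      t₁ ℚ.* (c ℚ.+ d) ℚ.* d ℚ.- t₀ ℚ.* d ℚ.* (c ℚ.+ d)  ≡⟨ cong (λ z → z ℚ.* d ℚ.- t₀ ℚ.* d ℚ.* (c ℚ.+ d)) h₁ ⟨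
      (t∞ ℚ.* c ℚ.+ t₀ ℚ.* d) ℚ.* d ℚ.- t₀ ℚ.* d ℚ.* (c ℚ.+ d) ≡⟨ collect t₀ t∞ c d ⟩
      D                                                  ∎
      where
      expand : ∀ t₀ t₁ c d → (t₁ ℚ.- t₀) ℚ.* (d ℚ.* (c ℚ.+ d)) ≡ t₁ ℚ.* (c ℚ.+ d) ℚ.* d ℚ.- t₀ ℚ.* d ℚ.* (c ℚ.+ d)
      expand = solve-∀-in ℚ-ring
      collect : ∀ t₀ t∞ c d → (t∞ ℚ.* c ℚ.+ t₀ ℚ.* d) ℚ.* d ℚ.- t₀ ℚ.* d ℚ.* (c ℚ.+ d) ≡ t∞ ℚ.* c ℚ.* d ℚ.- t₀ ℚ.* d ℚ.* c
      collect = solve-∀-in ℚ-ring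

    Y-rel : (t∞ ℚ.- t₁) ℚ.* (c ℚ.* (c ℚ.+ d)) ≡ D
    Y-rel = begin
      (t∞ ℚ.- t₁) ℚ.* (c ℚ.* (c ℚ.+ d))                    ≡⟨ expand t₁ t∞ c d ⟩
      t∞ ℚ.* c ℚ.* (c ℚ.+ d) ℚ.- t₁ ℚ.* (c ℚ.+ d) ℚ.* c    ≡⟨ cong (λ z → t∞ ℚ.* c ℚ.* (c ℚ.+ d) ℚ.- z ℚ.* c) h₁ ⟨
      t∞ ℚ.* c ℚ.* (c ℚ.+ d) ℚ.- (t∞ ℚ.* c ℚ.+ t₀ ℚ.* d) ℚ.* c ≡⟨ collect t₀ t∞ c d ⟩
      D                                                    ∎
      where
      expand : ∀ t₁ t∞ c d → (t∞ ℚ.- t₁) ℚ.* (c ℚ.* (c ℚ.+ d)) ≡ t∞ ℚ.* c ℚ.* (c ℚ.+ d) ℚ.- t₁ ℚ.* (c ℚ.+ d) ℚ.* c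
      expand = solve-∀-in ℚ-ring
      collect : ∀ t₀ t∞ c d → t∞ ℚ.* c ℚ.* (c ℚ.+ d) ℚ.- (t∞ ℚ.* c ℚ.+ t₀ ℚ.* d) ℚ.* c ≡ t∞ ℚ.* c ℚ.* d ℚ.- t₀ ℚ.* d ℚ.* c
      collect = solve-∀-in ℚ-ring

    W-rel : (t∞ ℚ.- t₀) ℚ.* (c ℚ.* d) ≡ D
    W-rel = expand t₀ t∞ c d
      where
      expand : ∀ t₀ t∞ c d → (t∞ ℚ.- t₀) ℚ.* (c ℚ.* d) ≡ t∞ ℚ.* c ℚ.* d ℚ.- t₀ ℚ.* d ℚ.* c
      expand = solve-∀-in ℚ-ring

    product-rel : (t₁ ℚ.- t₀) ℚ.* (t∞ ℚ.- t₁) ℚ.* (t∞ ℚ.- t₀) ℚ.* ((c ℚ.* d ℚ.* (c ℚ.+ d)) ℚ.* (c ℚ.* d ℚ.* (c ℚ.+ d)))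
                  ≡ D ℚ.* (D ℚ.* D)
    product-rel = trans (regroup (t₁ ℚ.- t₀) (t∞ ℚ.- t₁) (t∞ ℚ.- t₀) c d) (cong₂ ℚ._*_ X-rel (cong₂ ℚ._*_ Y-rel W-rel))
      where
      regroup : ∀ X Y W c d → X ℚ.* Y ℚ.* W ℚ.* ((c ℚ.* d ℚ.* (c ℚ.+ d)) ℚ.* (c ℚ.* d ℚ.* (c ℚ.+ d)))
                  ≡ (X ℚ.* (d ℚ.* (c ℚ.+ d))) ℚ.* ((Y ℚ.* (c ℚ.* (c ℚ.+ d))) ℚ.* (W ℚ.* (c ℚ.* d)))
      regroup = solve-∀-in ℚ-ring

-- For finite points, (t₁ - t₀) (t∞ - t₁) (t∞ - t₀) (c d (c + d))² = (a d - b c)³; when one point is ∞, a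
-- single difference times a square is a d - b c.
orientation : ∀ {a b c d} s₀ s₁ s∞ → a ℚ.* d ℚ.- b ℚ.* c ≢ 0ℚ →
              (a , c) ≐ s∞ → (b , d) ≐ s₀ → (a ℚ.+ b , c ℚ.+ d) ≐ s₁ →
              Cyclic s₀ s₁ s∞ ⇔ 0ℚ < a ℚ.* d ℚ.- b ℚ.* c
orientation {c = c} {d} (just t₀) (just t₁) (just t∞) D≢0 refl refl h₁ =
  ⇔.trans (cyclic⇔ t₀ t₁ t∞) (⇔.trans (pos⇔pos-*-square XYW P P≢0 product-rel) (⇔.sym (pos⇔pos-*-square D D D≢0 refl)))
  where
  open DifferenceRelations t₀ t₁ t∞ c d h₁
  D³≢0 : D ℚ.* (D ℚ.* D) ≢ 0ℚ
  D³≢0 D³≡0 = D≢0 (*≡0⇒≡0 D≢0 (*≡0⇒≡0 D≢0 D³≡0))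
  XYW = (t₁ ℚ.- t₀) ℚ.* (t∞ ℚ.- t₁) ℚ.* (t∞ ℚ.- t₀)
  P = c ℚ.* d ℚ.* (c ℚ.+ d)
  P≢0 : P ≢ 0ℚ
  P≢0 = *-square≢0 XYW P product-rel D³≢0
orientation {a} {d = d} (just t₀) (just t₁) nothing D≢0 refl refl h₁ =
  ⇔.trans (cyclic-∞⇔ t₀ t₁) (⇔.trans <⇔0<- (pos⇔pos-*-square (t₁ ℚ.- t₀) d (*-square≢0 (t₁ ℚ.- t₀) d X-rel D≢0) X-rel))
  where
  open ≡-Reasoning
  expand : ∀ t₀ t₁ d → (t₁ ℚ.- t₀) ℚ.* (d ℚ.* d) ≡ t₁ ℚ.* (0ℚ ℚ.+ d) ℚ.* d ℚ.- t₀ ℚ.* d ℚ.* d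
  expand = solve-∀-in ℚ-ring
  collect : ∀ a t₀ d → (a ℚ.+ t₀ ℚ.* d) ℚ.* d ℚ.- t₀ ℚ.* d ℚ.* d ≡ a ℚ.* d ℚ.- t₀ ℚ.* d ℚ.* 0ℚ
  collect = solve-∀-in ℚ-ring
  X-rel : (t₁ ℚ.- t₀) ℚ.* (d ℚ.* d) ≡ a ℚ.* d ℚ.- t₀ ℚ.* d ℚ.* 0ℚ
  X-rel = begin
    (t₁ ℚ.- t₀) ℚ.* (d ℚ.* d)                      ≡⟨ expand t₀ t₁ d ⟩
    t₁ ℚ.* (0ℚ ℚ.+ d) ℚ.* d ℚ.- t₀ ℚ.* d ℚ.* d      ≡⟨ cong (λ z → z ℚ.* d ℚ.- t₀ ℚ.* d ℚ.* d) h₁ ⟨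
    (a ℚ.+ t₀ ℚ.* d) ℚ.* d ℚ.- t₀ ℚ.* d ℚ.* d       ≡⟨ collect a t₀ d ⟩
    a ℚ.* d ℚ.- t₀ ℚ.* d ℚ.* 0ℚ                     ∎
orientation {b = b} {c} nothing (just t₁) (just t∞) D≢0 refl refl h₁ =
  ⇔.trans (∞-cyclic⇔ t₁ t∞) (⇔.trans <⇔0<- (pos⇔pos-*-square (t∞ ℚ.- t₁) c (*-square≢0 (t∞ ℚ.- t₁) c Y-rel D≢0) Y-rel))
  where
  open ≡-Reasoning
  expand : ∀ t₁ t∞ c → (t∞ ℚ.- t₁) ℚ.* (c ℚ.* c) ≡ t∞ ℚ.* c ℚ.* c ℚ.- t₁ ℚ.* (c ℚ.+ 0ℚ) ℚ.* c
  expand = solve-∀-in ℚ-ring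
  collect : ∀ b t∞ c → t∞ ℚ.* c ℚ.* c ℚ.- (t∞ ℚ.* c ℚ.+ b) ℚ.* c ≡ t∞ ℚ.* c ℚ.* 0ℚ ℚ.- b ℚ.* c
  collect = solve-∀-in ℚ-ring
  Y-rel : (t∞ ℚ.- t₁) ℚ.* (c ℚ.* c) ≡ t∞ ℚ.* c ℚ.* 0ℚ ℚ.- b ℚ.* c
  Y-rel = begin
    (t∞ ℚ.- t₁) ℚ.* (c ℚ.* c)                        ≡⟨ expand t₁ t∞ c ⟩
    t∞ ℚ.* c ℚ.* c ℚ.- t₁ ℚ.* (c ℚ.+ 0ℚ) ℚ.* c        ≡⟨ cong (λ z → t∞ ℚ.* c ℚ.* c ℚ.- z ℚ.* c) h₁ ⟨
    t∞ ℚ.* c ℚ.* c ℚ.- (t∞ ℚ.* c ℚ.+ b) ℚ.* c         ≡⟨ collect b t∞ c ⟩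
    t∞ ℚ.* c ℚ.* 0ℚ ℚ.- b ℚ.* c                       ∎
orientation {c = c} {d} (just t₀) nothing (just t∞) D≢0 refl refl c+d≡0 =
  ⇔.trans (cyclic∞⇔ t₀ t∞) (⇔.trans <⇔0<- (pos⇔pos-*-square (t₀ ℚ.- t∞) c (*-square≢0 (t₀ ℚ.- t∞) c W-rel D≢0) W-rel))
  where
  open ≡-Reasoning
  expand : ∀ t₀ t∞ c d → (t₀ ℚ.- t∞) ℚ.* (c ℚ.* c) ≡ (t∞ ℚ.- t₀) ℚ.* c ℚ.* d ℚ.- (t∞ ℚ.- t₀) ℚ.* c ℚ.* (c ℚ.+ d)
  expand = solve-∀-in ℚ-ring
  collect : ∀ t₀ t∞ c d → (t∞ ℚ.- t₀) ℚ.* c ℚ.* d ℚ.- (t∞ ℚ.- t₀) ℚ.* c ℚ.* 0ℚ ≡ t∞ ℚ.* c ℚ.* d ℚ.- t₀ ℚ.* d ℚ.* c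
  collect = solve-∀-in ℚ-ring
  W-rel : (t₀ ℚ.- t∞) ℚ.* (c ℚ.* c) ≡ t∞ ℚ.* c ℚ.* d ℚ.- t₀ ℚ.* d ℚ.* c
  W-rel = begin
    (t₀ ℚ.- t∞) ℚ.* (c ℚ.* c)                                        ≡⟨ expand t₀ t∞ c d ⟩
    (t∞ ℚ.- t₀) ℚ.* c ℚ.* d ℚ.- (t∞ ℚ.- t₀) ℚ.* c ℚ.* (c ℚ.+ d)
                     ≡⟨ cong (λ z → (t∞ ℚ.- t₀) ℚ.* c ℚ.* d ℚ.- (t∞ ℚ.- t₀) ℚ.* c ℚ.* z) c+d≡0 ⟩
    (t∞ ℚ.- t₀) ℚ.* c ℚ.* d ℚ.- (t∞ ℚ.- t₀) ℚ.* c ℚ.* 0ℚ             ≡⟨ collect t₀ t∞ c d ⟩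
    t∞ ℚ.* c ℚ.* d ℚ.- t₀ ℚ.* d ℚ.* c                                 ∎
orientation {a} {b} nothing _ nothing D≢0 refl refl _ = ⊥-elim (D≢0 (det-vanishes a b refl refl))
orientation {a} {b} {d = d} (just _) nothing nothing D≢0 refl refl 0+d≡0 =
  ⊥-elim (D≢0 (det-vanishes a b refl (trans (sym (ℚP.+-identityˡ d)) 0+d≡0)))
orientation {a} {b} {c} nothing nothing (just _) D≢0 refl refl c+0≡0 =
  ⊥-elim (D≢0 (det-vanishes a b (trans (sym (ℚP.+-identityʳ c)) c+0≡0) refl))

hom : ℚ∞ → ℚ × ℚ
hom (just τ) = τ , 1ℚ
hom nothing  = 1ℚ , 0ℚ

cross : ℚ × ℚ → ℚ × ℚ → ℚ
cross (x , y) (x' , y') = x ℚ.* y' ℚ.- x' ℚ.* y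

≐⇒cross≡0 : ∀ {v} s → v ≐ s → cross (hom s) v ≡ 0ℚ
≐⇒cross≡0 {_ , y} (just τ) refl = vanishing τ y
  where
  vanishing : ∀ τ y → τ ℚ.* y ℚ.- τ ℚ.* y ℚ.* 1ℚ ≡ 0ℚ
  vanishing = solve-∀-in ℚ-ring
≐⇒cross≡0 {x , _} nothing refl = vanishing x
  where
  vanishing : ∀ x → 1ℚ ℚ.* 0ℚ ℚ.- x ℚ.* 0ℚ ≡ 0ℚ
  vanishing = solve-∀-in ℚ-ring

≐-choice : ∀ v → ∃[ s ] v ≐ s
≐-choice (x , y) with y ℚP.≟ 0ℚ
... | yes y≡0 = nothing , y≡0
... | no y≢0 = just (x ℚ.* ℚ.1/ y) , (begin
  x                          ≡⟨ ℚP.*-identityʳ x ⟨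
  x ℚ.* 1ℚ                   ≡⟨ cong (x ℚ.*_) (ℚP.*-inverseˡ y) ⟨
  x ℚ.* (ℚ.1/ y ℚ.* y)       ≡⟨ ℚP.*-assoc x (ℚ.1/ y) y ⟨
  x ℚ.* ℚ.1/ y ℚ.* y         ∎)
  where
  open ≡-Reasoning
  instance
    _ : ℚ.NonZero y
    _ = ℚ.≢-nonZero y≢0

lift : ℚ × ℚ → Pt
lift (x , y) = ιℚ x , ιℚ y

infix 7 _⊗_
_⊗_ : Pt → Pt → ℚ[i]
(z , w) ⊗ (z' , w') = z *q w' +q -q (z' *q w)

⊗≡0⇒≈ₚ : ∀ P Q → P ⊗ Q ≡ 0q → P ≈ₚ Q
⊗≡0⇒≈ₚ (z , w) (z' , w') P⊗Q≡0 = begin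
  z *q w'                              ≡⟨ split (z *q w') (z' *q w) ⟩
  (z *q w' +q -q (z' *q w)) +q z' *q w ≡⟨ cong (_+q z' *q w) P⊗Q≡0 ⟩
  0q +q z' *q w                        ≡⟨ identity (z' *q w) ⟩
  z' *q w                              ∎
  where
  open ≡-Reasoning
  split : ∀ x y → x ≡ (x +q -q y) +q y
  split = solve-∀-in ℚ[i]-ring
  identity : ∀ x → 0q +q x ≡ x
  identity = solve-∀-in ℚ[i]-ring

≈ₚ⇒⊗≡0 : ∀ P Q → P ≈ₚ Q → P ⊗ Q ≡ 0q
≈ₚ⇒⊗≡0 (z , w) (z' , w') zw'≡z'w = trans (cong (_+q -q (z' *q w)) zw'≡z'w) (cancel (z' *q w))
  where
  cancel : ∀ x → x +q -q x ≡ 0q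
  cancel = solve-∀-in ℚ[i]-ring

fromℤ² : ℤ × ℤ → ℚ × ℚ
fromℤ² (x , y) = fromℤ x , fromℤ y

⊗-hom⇒≐ : ∀ z w s → (ι z , ι w) ⊗ lift (hom s) ≡ 0q →
          fromℤ² (re z , re w) ≐ s × fromℤ² (im z , im w) ≐ s
⊗-hom⇒≐ z w nothing ⊗≡0 =
    trans (one-times (fromℤ (re w)) (fromℤ (im w))) (trans (sym (cong req z0≡w)) (times-zero (fromℤ (re z)) (fromℤ (im z))))
  , trans (one-times′ (fromℤ (re w)) (fromℤ (im w))) (trans (sym (cong imq z0≡w)) (times-zero′ (fromℤ (re z)) (fromℤ (im z))))
  where
  z0≡w : ι z *q 0q ≡ 1q *q ι w
  z0≡w = ⊗≡0⇒≈ₚ (ι z , ι w) (1q , 0q) ⊗≡0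
  one-times : ∀ x y → x ≡ 1ℚ ℚ.* x ℚ.- 0ℚ ℚ.* y
  one-times = solve-∀-in ℚ-ring
  one-times′ : ∀ x y → y ≡ 1ℚ ℚ.* y ℚ.+ 0ℚ ℚ.* x
  one-times′ = solve-∀-in ℚ-ring
  times-zero : ∀ x y → x ℚ.* 0ℚ ℚ.- y ℚ.* 0ℚ ≡ 0ℚ
  times-zero = solve-∀-in ℚ-ring
  times-zero′ : ∀ x y → x ℚ.* 0ℚ ℚ.+ y ℚ.* 0ℚ ≡ 0ℚ
  times-zero′ = solve-∀-in ℚ-ring
⊗-hom⇒≐ z w (just τ) ⊗≡0 =
    trans (times-one (fromℤ (re z)) (fromℤ (im z))) (trans (cong req z1≡τw) (times-real τ (fromℤ (re w)) (fromℤ (im w))))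
  , trans (times-one′ (fromℤ (re z)) (fromℤ (im z))) (trans (cong imq z1≡τw) (times-real′ τ (fromℤ (re w)) (fromℤ (im w))))
  where
  z1≡τw : ι z *q 1q ≡ ιℚ τ *q ι w
  z1≡τw = ⊗≡0⇒≈ₚ (ι z , ι w) (ιℚ τ , 1q) ⊗≡0
  times-one : ∀ x y → x ≡ x ℚ.* 1ℚ ℚ.- y ℚ.* 0ℚ
  times-one = solve-∀-in ℚ-ring
  times-one′ : ∀ x y → y ≡ x ℚ.* 0ℚ ℚ.+ y ℚ.* 1ℚ
  times-one′ = solve-∀-in ℚ-ring
  times-real : ∀ τ x y → τ ℚ.* x ℚ.- 0ℚ ℚ.* y ≡ τ ℚ.* x
  times-real = solve-∀-in ℚ-ring
  times-real′ : ∀ τ x y → τ ℚ.* y ℚ.+ 0ℚ ℚ.* x ≡ τ ℚ.* y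
  times-real′ = solve-∀-in ℚ-ring

lift-⊗ : ∀ v w → lift v ⊗ lift w ≡ ιℚ (cross v w)
lift-⊗ (x , y) (x' , y') = cong₂ _+_iq (real-part x y x' y') (imaginary-part x y x' y')
  where
  real-part : ∀ x y x' y' →
    (x ℚ.* y' ℚ.- 0ℚ ℚ.* 0ℚ) ℚ.+ ℚ.- (x' ℚ.* y ℚ.- 0ℚ ℚ.* 0ℚ) ≡ x ℚ.* y' ℚ.- x' ℚ.* y
  real-part = solve-∀-in ℚ-ring
  imaginary-part : ∀ x y x' y' →
    (x ℚ.* 0ℚ ℚ.+ 0ℚ ℚ.* y') ℚ.+ ℚ.- (x' ℚ.* 0ℚ ℚ.+ 0ℚ ℚ.* y) ≡ 0ℚ
  imaginary-part = solve-∀-in ℚ-ring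

infixr 6 _⊙_
_⊙_ : Mat → Pt → Pt
mat p q r s ⊙ (z , w) = ι p *q z +q ι q *q w , ι r *q z +q ι s *q w

act-⊙ : ∀ (M : GL₂) t → act M t ≡ proj₁ M ⊙ lift (hom t)
act-⊙ (mat p q r s , _) (just τ) = cong₂ _,_ (times-one (ι p) (ι q) (ιℚ τ)) (times-one (ι r) (ι s) (ιℚ τ))
  where
  times-one : ∀ a b t → a *q t +q b ≡ a *q t +q b *q 1q
  times-one = solve-∀-in ℚ[i]-ring
act-⊙ (mat p q r s , _) nothing = cong₂ _,_ (project (ι p) (ι q)) (project (ι r) (ι s))
  where
  project : ∀ a b → a ≡ a *q 1q +q b *q 0q
  project = solve-∀-in ℚ[i]-ring

-- From lax lattices to oriented circles

-- The integral matrix with columns (p , q) and (r , s), as in SameOrientedLattice, acting on ℚ².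
image : ℤ → ℤ → ℤ → ℤ → ℚ × ℚ → ℚ × ℚ
image p q r s (x , y) = fromℤ p ℚ.* x ℚ.+ fromℤ r ℚ.* y , fromℤ q ℚ.* x ℚ.+ fromℤ s ℚ.* y

ι-combination : ∀ c x y a b → ι (c *ᵍ (x *ᵍ a +ᵍ y *ᵍ b)) ≡ ι c *q (ι x *q ι a +q ι y *q ι b)
ι-combination c x y a b = begin
  ι (c *ᵍ (x *ᵍ a +ᵍ y *ᵍ b))            ≡⟨ ι-homo-* c _ ⟩
  ι c *q ι (x *ᵍ a +ᵍ y *ᵍ b)            ≡⟨ cong (ι c *q_) (ι-homo-+ (x *ᵍ a) (y *ᵍ b)) ⟩
  ι c *q (ι (x *ᵍ a) +q ι (y *ᵍ b))      ≡⟨ cong (ι c *q_) (cong₂ _+q_ (ι-homo-* x a) (ι-homo-* y b)) ⟩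
  ι c *q (ι x *q ι a +q ι y *q ι b)      ∎
  where open ≡-Reasoning

ιℚ-combination : ∀ a x b y → ιℚ a *q ιℚ x +q ιℚ b *q ιℚ y ≡ ιℚ (a ℚ.* x ℚ.+ b ℚ.* y)
ιℚ-combination a x b y = cong₂ _+_iq (real-part a x b y) (imaginary-part a x b y)
  where
  real-part : ∀ a x b y → (a ℚ.* x ℚ.- 0ℚ ℚ.* 0ℚ) ℚ.+ (b ℚ.* y ℚ.- 0ℚ ℚ.* 0ℚ) ≡ a ℚ.* x ℚ.+ b ℚ.* y
  real-part = solve-∀-in ℚ-ring
  imaginary-part : ∀ a x b y → (a ℚ.* 0ℚ ℚ.+ 0ℚ ℚ.* x) ℚ.+ (b ℚ.* 0ℚ ℚ.+ 0ℚ ℚ.* y) ≡ 0ℚ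
  imaginary-part = solve-∀-in ℚ-ring

⊗-scaled-product : ∀ C M₁₁ M₁₂ M₂₁ M₂₂ P Q R S h₁ h₂ g₁ g₂ →
  (M₁₁ *q h₁ +q M₁₂ *q h₂ , M₂₁ *q h₁ +q M₂₂ *q h₂) ⊗
  (C *q (P *q M₁₁ +q Q *q M₁₂) *q g₁ +q C *q (R *q M₁₁ +q S *q M₁₂) *q g₂ ,
   C *q (P *q M₂₁ +q Q *q M₂₂) *q g₁ +q C *q (R *q M₂₁ +q S *q M₂₂) *q g₂)
  ≡ C *q (M₁₁ *q M₂₂ +q -q (M₁₂ *q M₂₁)) *q ((h₁ , h₂) ⊗ (P *q g₁ +q R *q g₂ , Q *q g₁ +q S *q g₂))
⊗-scaled-product = expanded
  where
  expanded : ∀ C M₁₁ M₁₂ M₂₁ M₂₂ P Q R S h₁ h₂ g₁ g₂ →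
    (M₁₁ *q h₁ +q M₁₂ *q h₂) *q (C *q (P *q M₂₁ +q Q *q M₂₂) *q g₁ +q C *q (R *q M₂₁ +q S *q M₂₂) *q g₂)
    +q -q ((C *q (P *q M₁₁ +q Q *q M₁₂) *q g₁ +q C *q (R *q M₁₁ +q S *q M₁₂) *q g₂) *q (M₂₁ *q h₁ +q M₂₂ *q h₂))
    ≡ C *q (M₁₁ *q M₂₂ +q -q (M₁₂ *q M₂₁)) *q (h₁ *q (Q *q g₁ +q S *q g₂) +q -q ((P *q g₁ +q R *q g₂) *q h₂))
  expanded = solve-∀-in ℚ[i]-ring

change-of-basis-≈ₚ : ∀ (M N : GL₂) c p q r s →
  proj₁ (cols N) ≡ c ·ᵛ (p ·ℤ proj₁ (cols M) +ᵛ q ·ℤ proj₂ (cols M)) →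
  proj₂ (cols N) ≡ c ·ᵛ (r ·ℤ proj₁ (cols M) +ᵛ s ·ℤ proj₂ (cols M)) →
  ∀ t u → cross (hom t) (image p q r s (hom u)) ≡ 0ℚ → act M t ≈ₚ act N u
change-of-basis-≈ₚ M@(mat m₁₁ m₁₂ m₂₁ m₂₂ , _) N@(mat _ _ _ _ , _) c p q r s refl refl t u t∥Ru =
  ⊗≡0⇒≈ₚ (act M t) (act N u) (begin
    act M t ⊗ act N u                                        ≡⟨ cong₂ _⊗_ (act-⊙ M t) (act-⊙ N u) ⟩
    (proj₁ M ⊙ h) ⊗ (proj₁ N ⊙ g)                            ≡⟨ cong ((proj₁ M ⊙ h) ⊗_) N⊙g ⟩
    (proj₁ M ⊙ h) ⊗ (C *q (P *q M₁₁ +q Q *q M₁₂) *q g₁ +q C *q (R *q M₁₁ +q S *q M₁₂) *q g₂ ,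
                     C *q (P *q M₂₁ +q Q *q M₂₂) *q g₁ +q C *q (R *q M₂₁ +q S *q M₂₂) *q g₂)
                                                             ≡⟨ ⊗-scaled-product C M₁₁ M₁₂ M₂₁ M₂₂ P Q R S h₁ h₂ g₁ g₂ ⟩
    C *q detM *q (h ⊗ (P *q g₁ +q R *q g₂ , Q *q g₁ +q S *q g₂))
                                                             ≡⟨ cong (C *q detM *q_) (cong (h ⊗_) (cong₂ _,_
                                                                  (ιℚ-combination (fromℤ p) _ (fromℤ r) _)
                                                                  (ιℚ-combination (fromℤ q) _ (fromℤ s) _))) ⟩
    C *q detM *q (h ⊗ lift (image p q r s (hom u)))          ≡⟨ cong (C *q detM *q_) (lift-⊗ (hom t) (image p q r s (hom u))) ⟩
    C *q detM *q ιℚ (cross (hom t) (image p q r s (hom u)))  ≡⟨ cong (λ z → C *q detM *q ιℚ z) t∥Ru ⟩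
    C *q detM *q 0q                                          ≡⟨ zeroʳ (C *q detM) ⟩
    0q                                                       ∎)
  where
  open ≡-Reasoning
  h = lift (hom t)
  g = lift (hom u)
  h₁ = proj₁ h
  h₂ = proj₂ h
  g₁ = proj₁ g
  g₂ = proj₂ g
  C = ι c
  M₁₁ = ι m₁₁
  M₁₂ = ι m₁₂
  M₂₁ = ι m₂₁
  M₂₂ = ι m₂₂
  P = ι (real p)
  Q = ι (real q)
  R = ι (real r)
  S = ι (real s)
  detM = M₁₁ *q M₂₂ +q -q (M₁₂ *q M₂₁)
  N⊙g : proj₁ N ⊙ g ≡ (C *q (P *q M₁₁ +q Q *q M₁₂) *q g₁ +q C *q (R *q M₁₁ +q S *q M₁₂) *q g₂ ,
                       C *q (P *q M₂₁ +q Q *q M₂₂) *q g₁ +q C *q (R *q M₂₁ +q S *q M₂₂) *q g₂)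
  N⊙g = cong₂ _,_
    (cong₂ (λ x y → x *q g₁ +q y *q g₂) (ι-combination c (real p) (real q) m₁₁ m₁₂) (ι-combination c (real r) (real s) m₁₁ m₁₂))
    (cong₂ (λ x y → x *q g₁ +q y *q g₂) (ι-combination c (real p) (real q) m₂₁ m₂₂) (ι-combination c (real r) (real s) m₂₁ m₂₂))
  zeroʳ : ∀ x → x *q 0q ≡ 0q
  zeroʳ = solve-∀-in ℚ[i]-ring

cross-adjugate : ∀ p q r s h g → cross h (image p q r s g) ≡ cross (image s (ℤ.- q) (ℤ.- r) p h) g
cross-adjugate p q r s (h₁ , h₂) (g₁ , g₂)
  rewrite fromℤ-homo-neg q | fromℤ-homo-neg r = expanded (fromℤ p) (fromℤ q) (fromℤ r) (fromℤ s) h₁ h₂ g₁ g₂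
  where
  expanded : ∀ P Q R S h₁ h₂ g₁ g₂ →
    h₁ ℚ.* (Q ℚ.* g₁ ℚ.+ S ℚ.* g₂) ℚ.- (P ℚ.* g₁ ℚ.+ R ℚ.* g₂) ℚ.* h₂ ≡
    (S ℚ.* h₁ ℚ.+ ℚ.- R ℚ.* h₂) ℚ.* g₂ ℚ.- g₁ ℚ.* (ℚ.- Q ℚ.* h₁ ℚ.+ P ℚ.* h₂)
  expanded = solve-∀-in ℚ-ring

cross-antisym : ∀ v w → cross v w ≡ ℚ.- cross w v
cross-antisym (x , y) (x' , y') = expanded x y x' y'
  where
  expanded : ∀ x y x' y' → x ℚ.* y' ℚ.- x' ℚ.* y ≡ ℚ.- (x' ℚ.* y ℚ.- x ℚ.* y')
  expanded = solve-∀-in ℚ-ring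

image-∞ : ∀ p q r s → image p q r s (hom nothing) ≡ (fromℤ p , fromℤ q)
image-∞ p q r s = cong₂ _,_ (expanded (fromℤ p) (fromℤ r)) (expanded (fromℤ q) (fromℤ s))
  where
  expanded : ∀ x y → x ℚ.* 1ℚ ℚ.+ y ℚ.* 0ℚ ≡ x
  expanded = solve-∀-in ℚ-ring

image-0 : ∀ p q r s → image p q r s (hom (just 0ℚ)) ≡ (fromℤ r , fromℤ s)
image-0 p q r s = cong₂ _,_ (expanded (fromℤ p) (fromℤ r)) (expanded (fromℤ q) (fromℤ s))
  where
  expanded : ∀ x y → x ℚ.* 0ℚ ℚ.+ y ℚ.* 1ℚ ≡ y
  expanded = solve-∀-in ℚ-ring

image-1 : ∀ p q r s → image p q r s (hom (just 1ℚ)) ≡ (fromℤ p ℚ.+ fromℤ r , fromℤ q ℚ.+ fromℤ s)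
image-1 p q r s = cong₂ _,_ (expanded (fromℤ p) (fromℤ r)) (expanded (fromℤ q) (fromℤ s))
  where
  expanded : ∀ x y → x ℚ.* 1ℚ ℚ.+ y ℚ.* 1ℚ ≡ x ℚ.+ y
  expanded = solve-∀-in ℚ-ring

SL₂-cyclic : ∀ p q r s → p ℤ.* s ℤ.- q ℤ.* r ≡ + 1 → ∀ {s₀ s₁ s∞} →
  image p q r s (hom nothing) ≐ s∞ → image p q r s (hom (just 0ℚ)) ≐ s₀ → image p q r s (hom (just 1ℚ)) ≐ s₁ →
  Cyclic s₀ s₁ s∞
SL₂-cyclic p q r s det≡1 {s₀} {s₁} {s∞} ≐∞ ≐₀ ≐₁ =
  Equivalence.from (orientation s₀ s₁ s∞ D≢0 (subst (_≐ s∞) (image-∞ p q r s) ≐∞)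
                                             (subst (_≐ s₀) (image-0 p q r s) ≐₀)
                                             (subst (_≐ s₁) (image-1 p q r s) ≐₁))
                   (subst (0ℚ <_) (sym D≡1) (ℚP.positive⁻¹ 1ℚ))
  where
  open ≡-Reasoning
  D≡1 : fromℤ p ℚ.* fromℤ s ℚ.- fromℤ r ℚ.* fromℤ q ≡ 1ℚ
  D≡1 = begin
    fromℤ p ℚ.* fromℤ s ℚ.- fromℤ r ℚ.* fromℤ q   ≡⟨ fromℤ-homo-det p r q s ⟨
    fromℤ (p ℤ.* s ℤ.- r ℤ.* q)                   ≡⟨ cong fromℤ (reorder p q r s) ⟩
    fromℤ (p ℤ.* s ℤ.- q ℤ.* r)                   ≡⟨ cong fromℤ det≡1 ⟩
    1ℚ                                             ∎
    where
    reorder : ∀ p q r s → p ℤ.* s ℤ.- r ℤ.* q ≡ p ℤ.* s ℤ.- q ℤ.* r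
    reorder = solve-∀
  D≢0 : fromℤ p ℚ.* fromℤ s ℚ.- fromℤ r ℚ.* fromℤ q ≢ 0ℚ
  D≢0 D≡0 with trans (sym D≡1) D≡0
  ... | ()

change-of-basis⇒sameCircle : ∀ (M N : GL₂) c p q r s → p ℤ.* s ℤ.- q ℤ.* r ≡ + 1 →
  proj₁ (cols N) ≡ c ·ᵛ (p ·ℤ proj₁ (cols M) +ᵛ q ·ℤ proj₂ (cols M)) →
  proj₂ (cols N) ≡ c ·ᵛ (r ·ℤ proj₁ (cols M) +ᵛ s ·ℤ proj₂ (cols M)) →
  SameOrientedCircle M N
change-of-basis⇒sameCircle M N c p q r s det≡1 a≡ b≡ =
  forward , backward , s₀ , s₁ , s∞ , preimage-≈ₚ (just 0ℚ) s₀ ≐₀ , preimage-≈ₚ (just 1ℚ) s₁ ≐₁ , preimage-≈ₚ nothing s∞ ≐∞ ,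
  SL₂-cyclic s (ℤ.- q) (ℤ.- r) p (trans (adjugate-det p q r s) det≡1) ≐∞ ≐₀ ≐₁
  where
  open ≡-Reasoning
  ≈ₚ-of = change-of-basis-≈ₚ M N c p q r s a≡ b≡
  -- R⁻¹ = adj R, as det R = 1
  preimage = image s (ℤ.- q) (ℤ.- r) p
  adjugate-det : ∀ p q r s → s ℤ.* p ℤ.- (ℤ.- q) ℤ.* (ℤ.- r) ≡ p ℤ.* s ℤ.- q ℤ.* r
  adjugate-det = solve-∀
  preimage-≈ₚ : ∀ t u → preimage (hom t) ≐ u → act M t ≈ₚ act N u
  preimage-≈ₚ t u ≐u = ≈ₚ-of t u (begin
    cross (hom t) (image p q r s (hom u)) ≡⟨ cross-adjugate p q r s (hom t) (hom u) ⟩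
    cross (preimage (hom t)) (hom u)      ≡⟨ cross-antisym (preimage (hom t)) (hom u) ⟩
    ℚ.- cross (hom u) (preimage (hom t))  ≡⟨ cong ℚ.-_ (≐⇒cross≡0 u ≐u) ⟩
    0ℚ                                    ∎)
  forward : ∀ t → ∃[ u ] act M t ≈ₚ act N u
  forward t with ≐-choice (preimage (hom t))
  ... | u , ≐u = u , preimage-≈ₚ t u ≐u
  backward : ∀ u → ∃[ t ] act N u ≈ₚ act M t
  backward u with ≐-choice (image p q r s (hom u))
  ... | t , ≐t = t , sym (≈ₚ-of t u (≐⇒cross≡0 t ≐t))
  s∞ = proj₁ (≐-choice (preimage (hom nothing)))
  ≐∞ = proj₂ (≐-choice (preimage (hom nothing)))
  s₀ = proj₁ (≐-choice (preimage (hom (just 0ℚ))))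
  ≐₀ = proj₂ (≐-choice (preimage (hom (just 0ℚ))))
  s₁ = proj₁ (≐-choice (preimage (hom (just 1ℚ))))
  ≐₁ = proj₂ (≐-choice (preimage (hom (just 1ℚ))))

sameLax⇒sameCircle : ∀ M N → SameLaxLattice (cols M) (cols N) → SameOrientedCircle M N
sameLax⇒sameCircle M N (inj₁ ((p , q , r , s , a≡ , b≡ , det≡1) , _)) =
  change-of-basis⇒sameCircle M N 1ᵍ p q r s det≡1 (trans a≡ (sym (·ᵛ-identity _))) (trans b≡ (sym (·ᵛ-identity _)))
sameLax⇒sameCircle M N (inj₂ ((p , q , r , s , ia≡ , ib≡ , det≡1) , _)) =
  change-of-basis⇒sameCircle M N (-ᵍ iᵍ) p q r s det≡1 (unrotate ia≡) (unrotate ib≡)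
  where
  unrotate : ∀ {v w} → iᵍ ·ᵛ v ≡ w → v ≡ (-ᵍ iᵍ) ·ᵛ w
  unrotate {v} refl = trans (sym (·ᵛ-identity v)) (·ᵛ-assoc (-ᵍ iᵍ) iᵍ v)

-- Gaussian matrices with real columns

crossℤ : ℤ × ℤ → ℤ × ℤ → ℤ
crossℤ (x , y) (x' , y') = x ℤ.* y' ℤ.- x' ℤ.* y

0² : ℤ × ℤ
0² = + 0 , + 0

Re Im : V → ℤ × ℤ
Re ⟨ x , y ⟩ = re x , re y
Im ⟨ x , y ⟩ = im x , im y

IsPM1 : ℤ → Set
IsPM1 z = z ≡ + 1 ⊎ z ≡ -[1+ 0 ]

unit-parts : ∀ {z} → IsUnit z → (IsPM1 (re z) × im z ≡ + 0) ⊎ (re z ≡ + 0 × IsPM1 (im z))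
unit-parts +1ᵘ = inj₁ (inj₁ refl , refl)
unit-parts -1ᵘ = inj₁ (inj₂ refl , refl)
unit-parts +iᵘ = inj₂ (refl , inj₁ refl)
unit-parts -iᵘ = inj₂ (refl , inj₂ refl)

PM1-neg : ∀ {z} → IsPM1 z → IsPM1 (ℤ.- z)
PM1-neg (inj₁ refl) = inj₂ refl
PM1-neg (inj₂ refl) = inj₁ refl

PM1≢0 : ∀ {z} → IsPM1 z → z ≢ + 0
PM1≢0 (inj₁ refl) ()
PM1≢0 (inj₂ refl) ()

even≢PM1 : ∀ E → ¬ IsPM1 (+ 2 ℤ.* E)
even≢PM1 E pm1 = odd {ℤ.∣ E ∣} (trans (sym (ℤP.abs-* (+ 2) E)) (∣PM1∣ pm1))
  where
  ∣PM1∣ : ∀ {z} → IsPM1 z → ℤ.∣ z ∣ ≡ 1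
  ∣PM1∣ (inj₁ refl) = refl
  ∣PM1∣ (inj₂ refl) = refl
  odd : ∀ {n} → ¬ 2 ℕ.* n ≡ 1
  odd {ℕ.zero} ()
  odd {ℕ.suc n} 2+2n≡1 with ℕP.m+n≡0⇒n≡0 n (cong ℕ.pred 2+2n≡1)
  ... | ()

ℤ-*≡0⇒≡0 : ∀ x {y} → x ≢ + 0 → x ℤ.* y ≡ + 0 → y ≡ + 0
ℤ-*≡0⇒≡0 x x≢0 xy≡0 with ℤP.i*j≡0⇒i≡0∨j≡0 _ xy≡0
... | inj₁ x≡0 = contradiction x≡0 x≢0
... | inj₂ y≡0 = y≡0

parallel-to-basis⇒0 : ∀ a₁ a₂ b → crossℤ a₁ a₂ ≢ + 0 → crossℤ a₁ b ≡ + 0 → crossℤ a₂ b ≡ + 0 → b ≡ 0²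
parallel-to-basis⇒0 (p , r) (q , s) (x , y) det≢0 a₁∥b a₂∥b =
  cong₂ _,_ (ℤ-*≡0⇒≡0 _ det≢0 (trans (solve-x p q r s x y) (vanish q p a₁∥b a₂∥b)))
            (ℤ-*≡0⇒≡0 _ det≢0 (trans (solve-y p q r s x y) (vanish s r a₁∥b a₂∥b)))
  where
  solve-x : ∀ p q r s x y → (p ℤ.* s ℤ.- q ℤ.* r) ℤ.* x ≡ q ℤ.* (p ℤ.* y ℤ.- x ℤ.* r) ℤ.- p ℤ.* (q ℤ.* y ℤ.- x ℤ.* s)
  solve-x = solve-∀
  solve-y : ∀ p q r s x y → (p ℤ.* s ℤ.- q ℤ.* r) ℤ.* y ≡ s ℤ.* (p ℤ.* y ℤ.- x ℤ.* r) ℤ.- r ℤ.* (q ℤ.* y ℤ.- x ℤ.* s)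
  solve-y = solve-∀
  vanish : ∀ u v {C₁ C₂} → C₁ ≡ + 0 → C₂ ≡ + 0 → u ℤ.* C₁ ℤ.- v ℤ.* C₂ ≡ + 0
  vanish u v refl refl = cong₂ ℤ._-_ (ℤP.*-zeroʳ u) (ℤP.*-zeroʳ v)

crossℤ≡0-sym : ∀ a b → crossℤ a b ≡ + 0 → crossℤ b a ≡ + 0
crossℤ≡0-sym (x , y) (x' , y') a×b≡0 = trans (antisym x y x' y') (cong ℤ.-_ a×b≡0)
  where
  antisym : ∀ x y x' y' → x' ℤ.* y ℤ.- x ℤ.* y' ≡ ℤ.- (x ℤ.* y' ℤ.- x' ℤ.* y)
  antisym = solve-∀

private
  module DeterminantOfColumns (k₁ k₂ : V)
    (a₁∥b₁ : crossℤ (Re k₁) (Im k₁) ≡ + 0) (a₂∥b₂ : crossℤ (Re k₂) (Im k₂) ≡ + 0)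
    (a∥b : crossℤ (Re (k₁ +ᵛ k₂)) (Im (k₁ +ᵛ k₂)) ≡ + 0) where
    a₁₁ = re (fst k₁)
    b₁₁ = im (fst k₁)
    a₂₁ = re (snd k₁)
    b₂₁ = im (snd k₁)
    a₁₂ = re (fst k₂)
    b₁₂ = im (fst k₂)
    a₂₂ = re (snd k₂)
    b₂₂ = im (snd k₂)
    re-det : re (det₂ k₁ k₂) ≡ crossℤ (Re k₁) (Re k₂) ℤ.- crossℤ (Im k₁) (Im k₂)
    re-det = expanded a₁₁ b₁₁ a₂₁ b₂₁ a₁₂ b₁₂ a₂₂ b₂₂
      where
      expanded : ∀ a₁₁ b₁₁ a₂₁ b₂₁ a₁₂ b₁₂ a₂₂ b₂₂ →
        (a₁₁ ℤ.* a₂₂ ℤ.- b₁₁ ℤ.* b₂₂) ℤ.+ ℤ.- (a₁₂ ℤ.* a₂₁ ℤ.- b₁₂ ℤ.* b₂₁)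
        ≡ (a₁₁ ℤ.* a₂₂ ℤ.- a₁₂ ℤ.* a₂₁) ℤ.- (b₁₁ ℤ.* b₂₂ ℤ.- b₁₂ ℤ.* b₂₁)
      expanded = solve-∀
    im-det : im (det₂ k₁ k₂) ≡ crossℤ (Re k₁) (Im k₂) ℤ.+ crossℤ (Im k₁) (Re k₂)
    im-det = expanded a₁₁ b₁₁ a₂₁ b₂₁ a₁₂ b₁₂ a₂₂ b₂₂
      where
      expanded : ∀ a₁₁ b₁₁ a₂₁ b₂₁ a₁₂ b₁₂ a₂₂ b₂₂ →
        (a₁₁ ℤ.* b₂₂ ℤ.+ b₁₁ ℤ.* a₂₂) ℤ.+ ℤ.- (a₁₂ ℤ.* b₂₁ ℤ.+ b₁₂ ℤ.* a₂₁)
        ≡ (a₁₁ ℤ.* b₂₂ ℤ.- b₁₂ ℤ.* a₂₁) ℤ.+ (b₁₁ ℤ.* a₂₂ ℤ.- a₁₂ ℤ.* b₂₁)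
      expanded = solve-∀
    cross-sum : crossℤ (Re (k₁ +ᵛ k₂)) (Im (k₁ +ᵛ k₂)) ≡
      crossℤ (Re k₁) (Im k₁) ℤ.+ crossℤ (Re k₂) (Im k₂) ℤ.+ (crossℤ (Re k₁) (Im k₂) ℤ.- crossℤ (Im k₁) (Re k₂))
    cross-sum = expanded a₁₁ b₁₁ a₂₁ b₂₁ a₁₂ b₁₂ a₂₂ b₂₂
      where
      expanded : ∀ a₁₁ b₁₁ a₂₁ b₂₁ a₁₂ b₁₂ a₂₂ b₂₂ →
        (a₁₁ ℤ.+ a₁₂) ℤ.* (b₂₁ ℤ.+ b₂₂) ℤ.- (b₁₁ ℤ.+ b₁₂) ℤ.* (a₂₁ ℤ.+ a₂₂) ≡
        (a₁₁ ℤ.* b₂₁ ℤ.- b₁₁ ℤ.* a₂₁) ℤ.+ (a₁₂ ℤ.* b₂₂ ℤ.- b₁₂ ℤ.* a₂₂)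
        ℤ.+ ((a₁₁ ℤ.* b₂₂ ℤ.- b₁₂ ℤ.* a₂₁) ℤ.- (b₁₁ ℤ.* a₂₂ ℤ.- a₁₂ ℤ.* b₂₁))
      expanded = solve-∀

    open ≡-Reasoning
    E = crossℤ (Re k₁) (Im k₂)
    F = crossℤ (Im k₁) (Re k₂)

    E≡F : E ≡ F
    E≡F = ℤP.i-j≡0⇒i≡j E F (begin
      E ℤ.- F                                                   ≡⟨ drop-zeros (E ℤ.- F) ⟨
      + 0 ℤ.+ + 0 ℤ.+ (E ℤ.- F)                                 ≡⟨ cong₂ (λ u v → u ℤ.+ v ℤ.+ (E ℤ.- F)) a₁∥b₁ a₂∥b₂ ⟨
      crossℤ (Re k₁) (Im k₁) ℤ.+ crossℤ (Re k₂) (Im k₂) ℤ.+ (E ℤ.- F) ≡⟨ cross-sum ⟨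
      crossℤ (Re (k₁ +ᵛ k₂)) (Im (k₁ +ᵛ k₂))                    ≡⟨ a∥b ⟩
      + 0                                                       ∎)
      where
      drop-zeros : ∀ x → + 0 ℤ.+ + 0 ℤ.+ x ≡ x
      drop-zeros = solve-∀

    im≡2E : im (det₂ k₁ k₂) ≡ + 2 ℤ.* E
    im≡2E = trans im-det (trans (cong (λ x → E ℤ.+ x) (sym E≡F)) (double E))
      where
      double : ∀ x → x ℤ.+ x ≡ + 2 ℤ.* x
      double = solve-∀

parallel-columns⇒one-vanishes : ∀ a₁ a₂ b₁ b₂ →
  crossℤ a₁ b₁ ≡ + 0 → crossℤ a₁ b₂ ≡ + 0 → crossℤ a₂ b₁ ≡ + 0 → crossℤ a₂ b₂ ≡ + 0 →
  IsPM1 (crossℤ a₁ a₂ ℤ.- crossℤ b₁ b₂) →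
  (b₁ ≡ 0² × b₂ ≡ 0² × IsPM1 (crossℤ a₁ a₂)) ⊎ (a₁ ≡ 0² × a₂ ≡ 0² × IsPM1 (crossℤ b₁ b₂))
parallel-columns⇒one-vanishes a₁ a₂ b₁ b₂ a₁∥b₁ a₁∥b₂ a₂∥b₁ a₂∥b₂ pm1 with crossℤ a₁ a₂ ℤ.≟ + 0
... | no A≢0 = inj₁ (b₁≡0 , b₂≡0 , subst IsPM1 (ℤP.+-identityʳ (crossℤ a₁ a₂)) A-0-PM1)
  where
  b₁≡0 = parallel-to-basis⇒0 a₁ a₂ b₁ A≢0 a₁∥b₁ a₂∥b₁
  b₂≡0 = parallel-to-basis⇒0 a₁ a₂ b₂ A≢0 a₁∥b₂ a₂∥b₂
  A-0-PM1 : IsPM1 (crossℤ a₁ a₂ ℤ.- crossℤ 0² 0²)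
  A-0-PM1 = subst₂ (λ u v → IsPM1 (crossℤ a₁ a₂ ℤ.- crossℤ u v)) b₁≡0 b₂≡0 pm1
... | yes A≡0 = inj₂ (a₁≡0 , a₂≡0 , B-PM1)
  where
  B-PM1 : IsPM1 (crossℤ b₁ b₂)
  B-PM1 = subst IsPM1 (ℤP.neg-involutive _)
            (PM1-neg (subst IsPM1 (trans (cong (ℤ._- crossℤ b₁ b₂) A≡0) (ℤP.+-identityˡ _)) pm1))
  a₁≡0 = parallel-to-basis⇒0 b₁ b₂ a₁ (PM1≢0 B-PM1) (crossℤ≡0-sym a₁ b₁ a₁∥b₁) (crossℤ≡0-sym a₁ b₂ a₁∥b₂)
  a₂≡0 = parallel-to-basis⇒0 b₁ b₂ a₂ (PM1≢0 B-PM1) (crossℤ≡0-sym a₂ b₁ a₂∥b₁) (crossℤ≡0-sym a₂ b₂ a₂∥b₂)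

-- Writing K = A + iB for the matrix with columns k₁ , k₂, the hypotheses make columns of A and B with the same
-- index parallel; then Im det K is twice a cross term, hence 0, and every column of A is parallel to every
-- column of B.
real-or-imaginary : ∀ k₁ k₂ → crossℤ (Re k₁) (Im k₁) ≡ + 0 → crossℤ (Re k₂) (Im k₂) ≡ + 0 →
  crossℤ (Re (k₁ +ᵛ k₂)) (Im (k₁ +ᵛ k₂)) ≡ + 0 → IsUnit (det₂ k₁ k₂) →
  (Im k₁ ≡ 0² × Im k₂ ≡ 0² × IsPM1 (crossℤ (Re k₁) (Re k₂))) ⊎
  (Re k₁ ≡ 0² × Re k₂ ≡ 0² × IsPM1 (crossℤ (Im k₁) (Im k₂)))
real-or-imaginary k₁ k₂ a₁∥b₁ a₂∥b₂ a∥b unit with unit-parts unit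
... | inj₂ (_ , im-PM1) = ⊥-elim (even≢PM1 E (subst IsPM1 im≡2E im-PM1))
  where open DeterminantOfColumns k₁ k₂ a₁∥b₁ a₂∥b₂ a∥b
... | inj₁ (re-PM1 , im≡0) = parallel-columns⇒one-vanishes (Re k₁) (Re k₂) (Im k₁) (Im k₂)
  a₁∥b₁ a₁∥b₂ (crossℤ≡0-sym (Im k₁) (Re k₂) (trans (sym E≡F) a₁∥b₂)) a₂∥b₂ (subst IsPM1 re-det re-PM1)
  where
  open DeterminantOfColumns k₁ k₂ a₁∥b₁ a₂∥b₂ a∥b
  a₁∥b₂ : E ≡ + 0
  a₁∥b₂ = ℤ-*≡0⇒≡0 (+ 2) (λ ()) (trans (sym im≡2E) im≡0)

-- From oriented circles to lax lattices

-- det₂ a b times the coordinates of v in the basis (a , b); for the columns of N this is adj(N) v.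
coordinates : V → V → V → V
coordinates a b v = ⟨ det₂ v b , det₂ a v ⟩

coordinates-+ : ∀ a b v w → coordinates a b (v +ᵛ w) ≡ coordinates a b v +ᵛ coordinates a b w
coordinates-+ ⟨ a₁ , a₂ ⟩ ⟨ b₁ , b₂ ⟩ ⟨ v₁ , v₂ ⟩ ⟨ w₁ , w₂ ⟩ =
  cong₂ ⟨_,_⟩ (additiveˡ v₁ v₂ w₁ w₂ b₁ b₂) (additiveʳ a₁ a₂ v₁ v₂ w₁ w₂)
  where
  additiveˡ : ∀ x₁ x₂ y₁ y₂ z₁ z₂ →
    (x₁ +ᵍ y₁) *ᵍ z₂ -ᵍ z₁ *ᵍ (x₂ +ᵍ y₂) ≡ (x₁ *ᵍ z₂ -ᵍ z₁ *ᵍ x₂) +ᵍ (y₁ *ᵍ z₂ -ᵍ z₁ *ᵍ y₂)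
  additiveˡ = solve-∀-in ℤ[i]-ring
  additiveʳ : ∀ z₁ z₂ x₁ x₂ y₁ y₂ →
    z₁ *ᵍ (x₂ +ᵍ y₂) -ᵍ (x₁ +ᵍ y₁) *ᵍ z₂ ≡ (z₁ *ᵍ x₂ -ᵍ x₁ *ᵍ z₂) +ᵍ (z₁ *ᵍ y₂ -ᵍ y₁ *ᵍ z₂)
  additiveʳ = solve-∀-in ℤ[i]-ring

coordinates-det : ∀ a b v w → det₂ (coordinates a b v) (coordinates a b w) ≡ det₂ a b *ᵍ det₂ v w
coordinates-det ⟨ a₁ , a₂ ⟩ ⟨ b₁ , b₂ ⟩ ⟨ v₁ , v₂ ⟩ ⟨ w₁ , w₂ ⟩ = expanded a₁ a₂ b₁ b₂ v₁ v₂ w₁ w₂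
  where
  expanded : ∀ a₁ a₂ b₁ b₂ v₁ v₂ w₁ w₂ →
    (v₁ *ᵍ b₂ -ᵍ b₁ *ᵍ v₂) *ᵍ (a₁ *ᵍ w₂ -ᵍ w₁ *ᵍ a₂) -ᵍ (w₁ *ᵍ b₂ -ᵍ b₁ *ᵍ w₂) *ᵍ (a₁ *ᵍ v₂ -ᵍ v₁ *ᵍ a₂)
    ≡ (a₁ *ᵍ b₂ -ᵍ b₁ *ᵍ a₂) *ᵍ (v₁ *ᵍ w₂ -ᵍ w₁ *ᵍ v₂)
  expanded = solve-∀-in ℤ[i]-ring

point : V → Pt
point ⟨ x , y ⟩ = ι x , ι y

ι-det₂ : ∀ u v → ι (det₂ u v) ≡ ι (fst u) *q ι (snd v) +q -q (ι (fst v) *q ι (snd u))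
ι-det₂ u v = begin
  ι (fst u *ᵍ snd v +ᵍ -ᵍ (fst v *ᵍ snd u))        ≡⟨ ι-homo-+ (fst u *ᵍ snd v) _ ⟩
  ι (fst u *ᵍ snd v) +q ι (-ᵍ (fst v *ᵍ snd u))    ≡⟨ cong₂ _+q_ (ι-homo-* (fst u) (snd v)) (ι-homo-neg (fst v *ᵍ snd u)) ⟩
  ι (fst u) *q ι (snd v) +q -q ι (fst v *ᵍ snd u)  ≡⟨ cong (λ z → ι (fst u) *q ι (snd v) +q -q z) (ι-homo-* (fst v) (snd u)) ⟩
  ι (fst u) *q ι (snd v) +q -q (ι (fst v) *q ι (snd u)) ∎
  where open ≡-Reasoning

coordinates-⊗ : ∀ (N : GL₂) x h → point (coordinates (proj₁ (cols N)) (proj₂ (cols N)) x) ⊗ h ≡ point x ⊗ (proj₁ N ⊙ h)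
coordinates-⊗ N@(mat n₁₁ n₁₂ n₂₁ n₂₂ , _) x@(⟨ x₁ , x₂ ⟩) (h₁ , h₂) =
  trans (cong₂ (λ u v → (u , v) ⊗ (h₁ , h₂)) (ι-det₂ x ⟨ n₁₂ , n₂₂ ⟩) (ι-det₂ ⟨ n₁₁ , n₂₁ ⟩ x))
        (adjugate (ι n₁₁) (ι n₁₂) (ι n₂₁) (ι n₂₂) (ι x₁) (ι x₂) h₁ h₂)
  where
  adjugate : ∀ n₁₁ n₁₂ n₂₁ n₂₂ x₁ x₂ h₁ h₂ →
    (x₁ *q n₂₂ +q -q (n₁₂ *q x₂)) *q h₂ +q -q (h₁ *q (n₁₁ *q x₂ +q -q (x₁ *q n₂₁)))
    ≡ x₁ *q (n₂₁ *q h₁ +q n₂₂ *q h₂) +q -q ((n₁₁ *q h₁ +q n₁₂ *q h₂) *q x₂)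
  adjugate = solve-∀-in ℚ[i]-ring

cramer-≐ : ∀ (N : GL₂) x s → point x ≈ₚ act N s →
  let k = coordinates (proj₁ (cols N)) (proj₂ (cols N)) x in fromℤ² (Re k) ≐ s × fromℤ² (Im k) ≐ s
cramer-≐ N x s x≈Ns = ⊗-hom⇒≐ (fst k) (snd k) s (begin
  point k ⊗ lift (hom s)                 ≡⟨ coordinates-⊗ N x (lift (hom s)) ⟩
  point x ⊗ (proj₁ N ⊙ lift (hom s))     ≡⟨ cong (point x ⊗_) (act-⊙ N s) ⟨
  point x ⊗ act N s                      ≡⟨ ≈ₚ⇒⊗≡0 (point x) (act N s) x≈Ns ⟩
  0q                                     ∎)
  where
  open ≡-Reasoning
  k = coordinates (proj₁ (cols N)) (proj₂ (cols N)) x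

≐-parallel : ∀ u v s → fromℤ² u ≐ s → fromℤ² v ≐ s → crossℤ u v ≡ + 0
≐-parallel (x , y) (x' , y') nothing y≡0 y'≡0
  rewrite fromℤ-injective {y} {+ 0} y≡0 | fromℤ-injective {y'} {+ 0} y'≡0 = vanishing x x'
  where
  vanishing : ∀ x x' → x ℤ.* + 0 ℤ.- x' ℤ.* + 0 ≡ + 0
  vanishing = solve-∀
≐-parallel (x , y) (x' , y') (just τ) x≡τy x'≡τy' = fromℤ-injective (begin
  fromℤ (x ℤ.* y' ℤ.- x' ℤ.* y)                          ≡⟨ fromℤ-homo-det x x' y y' ⟩
  fromℤ x ℚ.* fromℤ y' ℚ.- fromℤ x' ℚ.* fromℤ y          ≡⟨ cong₂ (λ u v → u ℚ.* fromℤ y' ℚ.- v ℚ.* fromℤ y) x≡τy x'≡τy' ⟩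
  τ ℚ.* fromℤ y ℚ.* fromℤ y' ℚ.- τ ℚ.* fromℤ y' ℚ.* fromℤ y ≡⟨ vanishing τ (fromℤ y) (fromℤ y') ⟩
  0ℚ                                                      ∎)
  where
  open ≡-Reasoning
  vanishing : ∀ τ a b → τ ℚ.* a ℚ.* b ℚ.- τ ℚ.* b ℚ.* a ≡ 0ℚ
  vanishing = solve-∀-in ℚ-ring

act-0 : ∀ (M : GL₂) → act M (just 0ℚ) ≡ point (proj₂ (cols M))
act-0 (mat p q r s , _) = cong₂ _,_ (vanishing (ι p) (ι q)) (vanishing (ι r) (ι s))
  where
  vanishing : ∀ a b → a *q 0q +q b ≡ b
  vanishing = solve-∀-in ℚ[i]-ring

act-1 : ∀ (M : GL₂) → act M (just 1ℚ) ≡ point (proj₁ (cols M) +ᵛ proj₂ (cols M))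
act-1 (mat p q r s , _) = cong₂ _,_ (trans (unit (ι p) (ι q)) (sym (ι-homo-+ p q))) (trans (unit (ι r) (ι s)) (sym (ι-homo-+ r s)))
  where
  unit : ∀ a b → a *q 1q +q b ≡ a +q b
  unit = solve-∀-in ℚ[i]-ring

coordinates-real⇒sameLax : ∀ (M N : GL₂) w p q r s → IsUnit w → crossℤ (p , q) (r , s) ≡ + 1 →
  coordinates (proj₁ (cols N)) (proj₂ (cols N)) (proj₁ (cols M)) ≡ w ·ᵛ ⟨ real p , real q ⟩ →
  coordinates (proj₁ (cols N)) (proj₂ (cols N)) (proj₂ (cols M)) ≡ w ·ᵛ ⟨ real r , real s ⟩ →
  SameLaxLattice (cols M) (cols N)
coordinates-real⇒sameLax M N@(_ , δᵘ) w p q r s wᵘ cross≡1 k₁≡ k₂≡ with unit-inverse δᵘ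
... | e , δe≡1 = sameLax-sym (subst₂ (λ x y → SameLaxLattice (cols N) (x , y)) (sym (recover _ _ _ k₁≡)) (sym (recover _ _ _ k₂≡))
                   (sameLax-unit (unit-* eᵘ wᵘ) (p , q , r , s , refl , refl , det≡1)))
  where
  open ≡-Reasoning
  a = proj₁ (cols N)
  b = proj₂ (cols N)
  δ = det₂ a b
  eᵘ : IsUnit e
  eᵘ = *≡1⇒unit e δ (trans (*ᵍ-comm e δ) δe≡1)
  det≡1 : p ℤ.* s ℤ.- q ℤ.* r ≡ + 1
  det≡1 = trans (reorder p q r s) cross≡1
    where
    reorder : ∀ p q r s → p ℤ.* s ℤ.- q ℤ.* r ≡ p ℤ.* s ℤ.- r ℤ.* q
    reorder = solve-∀
  recover : ∀ v x y → coordinates a b v ≡ w ·ᵛ ⟨ x , y ⟩ → v ≡ (e *ᵍ w) ·ᵛ (x ·ᵛ a +ᵛ y ·ᵛ b)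
  recover v x y k≡ = begin
    v                                              ≡⟨ ·ᵛ-identity v ⟨
    1ᵍ ·ᵛ v                                        ≡⟨ cong (_·ᵛ v) (trans (*ᵍ-comm e δ) δe≡1) ⟨
    (e *ᵍ δ) ·ᵛ v                                  ≡⟨ ·ᵛ-assoc e δ v ⟩
    e ·ᵛ (δ ·ᵛ v)                                  ≡⟨ cong (e ·ᵛ_) (cramer a b v) ⟨
    e ·ᵛ (det₂ v b ·ᵛ a +ᵛ det₂ a v ·ᵛ b)
                         ≡⟨ cong (e ·ᵛ_) (cong₂ (λ u u′ → u ·ᵛ a +ᵛ u′ ·ᵛ b) (cong fst k≡) (cong snd k≡)) ⟩
    e ·ᵛ ((w *ᵍ x) ·ᵛ a +ᵛ (w *ᵍ y) ·ᵛ b)          ≡⟨ cong (e ·ᵛ_) (cong₂ _+ᵛ_ (·ᵛ-assoc w x a) (·ᵛ-assoc w y b)) ⟩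
    e ·ᵛ (w ·ᵛ (x ·ᵛ a) +ᵛ w ·ᵛ (y ·ᵛ b))          ≡⟨ cong (e ·ᵛ_) (·ᵛ-distrib w _ _) ⟨
    e ·ᵛ (w ·ᵛ (x ·ᵛ a +ᵛ y ·ᵛ b))                 ≡⟨ ·ᵛ-assoc e w _ ⟨
    (e *ᵍ w) ·ᵛ (x ·ᵛ a +ᵛ y ·ᵛ b)                 ∎

PM1∧pos⇒+1 : ∀ {z} → IsPM1 z → 0ℚ ℚ.< fromℤ z → z ≡ + 1
PM1∧pos⇒+1 (inj₁ z≡1) _ = z≡1
PM1∧pos⇒+1 (inj₂ refl) 0<-1 = contradiction 0<-1 (ℚP.<-asym (ℚP.negative⁻¹ (ℚ.- 1ℚ)))

cyclic⇒det≡+1 : ∀ u v {s₀ s₁ s∞} →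
  fromℤ² u ≐ s∞ → fromℤ² v ≐ s₀ → fromℤ² (proj₁ u ℤ.+ proj₁ v , proj₂ u ℤ.+ proj₂ v) ≐ s₁ →
  Cyclic s₀ s₁ s∞ → IsPM1 (crossℤ u v) → crossℤ u v ≡ + 1
cyclic⇒det≡+1 (p , q) (r , s) {s₀} {s₁} {s∞} u≐ v≐ u+v≐ cyclic pm1 =
  PM1∧pos⇒+1 pm1 (subst (0ℚ <_) (sym (fromℤ-homo-det p r q s))
    (Equivalence.to (orientation s₀ s₁ s∞ D≢0 u≐ v≐ (subst (_≐ s₁) (cong₂ _,_ (fromℤ-homo-+ p r) (fromℤ-homo-+ q s)) u+v≐)) cyclic))
  where
  D≢0 : fromℤ p ℚ.* fromℤ s ℚ.- fromℤ r ℚ.* fromℤ q ≢ 0ℚ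
  D≢0 D≡0 = PM1≢0 pm1 (fromℤ-injective (trans (fromℤ-homo-det p r q s) D≡0))

real-coordinates : ∀ k → Im k ≡ 0² → k ≡ 1ᵍ ·ᵛ ⟨ real (re (fst k)) , real (re (snd k)) ⟩
real-coordinates ⟨ x , y ⟩ Im≡0 =
  trans (cong₂ (λ u v → ⟨ re x + u i , re y + v i ⟩) (cong proj₁ Im≡0) (cong proj₂ Im≡0)) (sym (·ᵛ-identity _))

imaginary-coordinates : ∀ k → Re k ≡ 0² → k ≡ iᵍ ·ᵛ ⟨ real (im (fst k)) , real (im (snd k)) ⟩
imaginary-coordinates ⟨ x , y ⟩ Re≡0 =
  trans (cong₂ (λ u v → ⟨ u + im x i , v + im y i ⟩) (cong proj₁ Re≡0) (cong proj₂ Re≡0))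
        (cong₂ ⟨_,_⟩ (times-i (im x)) (times-i (im y)))
  where
  times-i : ∀ n → (+ 0) + n i ≡ iᵍ *ᵍ real n
  times-i n = cong₂ _+_i (sym (real-part n)) (sym (imaginary-part n))
    where
    real-part : ∀ n → + 0 ℤ.* n ℤ.- + 1 ℤ.* + 0 ≡ + 0
    real-part = solve-∀
    imaginary-part : ∀ n → + 0 ℤ.* + 0 ℤ.+ + 1 ℤ.* n ≡ n
    imaginary-part = solve-∀

-- k₁ , k₂ are the columns of adj(N) M; as M(∞), M(0), M(1) lie on N(ℝ), the vectors k₁ , k₂ , k₁ + k₂ are
-- complex multiples of real vectors pointing at s∞ , s₀ , s₁.
sameCircle⇒sameLax : ∀ M N → SameOrientedCircle M N → SameLaxLattice (cols M) (cols N)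
sameCircle⇒sameLax M@(_ , δMᵘ) N@(_ , δNᵘ) (_ , _ , s₀ , s₁ , s∞ , h₀ , h₁ , h∞ , cyclic) =
  dispatch (real-or-imaginary k₁ k₂ (≐-parallel (Re k₁) (Im k₁) s∞ Re≐∞ Im≐∞) (≐-parallel (Re k₂) (Im k₂) s₀ Re≐₀ Im≐₀)
                                    (≐-parallel (Re (k₁ +ᵛ k₂)) (Im (k₁ +ᵛ k₂)) s₁ Re≐₁ Im≐₁) unit-det)
  where
  a = proj₁ (cols N)
  b = proj₂ (cols N)
  k₁ = coordinates a b (proj₁ (cols M))
  k₂ = coordinates a b (proj₂ (cols M))
  ≐∞ = cramer-≐ N (proj₁ (cols M)) s∞ h∞
  ≐₀ = cramer-≐ N (proj₂ (cols M)) s₀ (subst (_≈ₚ act N s₀) (act-0 M) h₀)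
  ≐₁ = subst (λ k → fromℤ² (Re k) ≐ s₁ × fromℤ² (Im k) ≐ s₁) (coordinates-+ a b (proj₁ (cols M)) (proj₂ (cols M)))
             (cramer-≐ N (proj₁ (cols M) +ᵛ proj₂ (cols M)) s₁ (subst (_≈ₚ act N s₁) (act-1 M) h₁))
  Re≐∞ = proj₁ ≐∞
  Im≐∞ = proj₂ ≐∞
  Re≐₀ = proj₁ ≐₀
  Im≐₀ = proj₂ ≐₀
  Re≐₁ = proj₁ ≐₁
  Im≐₁ = proj₂ ≐₁
  unit-det : IsUnit (det₂ k₁ k₂)
  unit-det = subst IsUnit (sym (coordinates-det a b (proj₁ (cols M)) (proj₂ (cols M)))) (unit-* δNᵘ δMᵘ)
  dispatch : (Im k₁ ≡ 0² × Im k₂ ≡ 0² × IsPM1 (crossℤ (Re k₁) (Re k₂))) ⊎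
             (Re k₁ ≡ 0² × Re k₂ ≡ 0² × IsPM1 (crossℤ (Im k₁) (Im k₂))) → SameLaxLattice (cols M) (cols N)
  dispatch (inj₁ (Im≡0₁ , Im≡0₂ , pm1)) =
    coordinates-real⇒sameLax M N 1ᵍ (re (fst k₁)) (re (snd k₁)) (re (fst k₂)) (re (snd k₂)) +1ᵘ
      (cyclic⇒det≡+1 (Re k₁) (Re k₂) Re≐∞ Re≐₀ Re≐₁ cyclic pm1)
      (real-coordinates k₁ Im≡0₁) (real-coordinates k₂ Im≡0₂)
  dispatch (inj₂ (Re≡0₁ , Re≡0₂ , pm1)) =
    coordinates-real⇒sameLax M N iᵍ (im (fst k₁)) (im (snd k₁)) (im (fst k₂)) (im (snd k₂)) +iᵘ
      (cyclic⇒det≡+1 (Im k₁) (Im k₂) Im≐∞ Im≐₀ Im≐₁ cyclic pm1)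
      (imaginary-coordinates k₁ Re≡0₁) (imaginary-coordinates k₂ Re≡0₂)

basis⇒matrix : ∀ a b → IsBasis a b → ∃[ M ] SameLaxLattice (cols M) (a , b)
basis⇒matrix a b basis = (mat (fst a) (fst b) (snd a) (snd b) , basis⇒unit-det₂ basis) , sameLax-refl a b

proposition3p2 :
    -- the columns of a matrix in GL₂(ℤ[i]) form an ordered ℤ[i]-basis (the map lands in lax lattices)
    (∀ (M : GL₂) → IsBasis (proj₁ (cols M)) (proj₂ (cols M))) ×
    -- well defined: equal oriented Gaussian circles give equal lax lattices
    (∀ (M N : GL₂) → SameOrientedCircle M N → SameLaxLattice (cols M) (cols N)) ×
    -- injective
    (∀ (M N : GL₂) → SameLaxLattice (cols M) (cols N) → SameOrientedCircle M N) ×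
    -- surjective
    (∀ (a b : V) → IsBasis a b → ∃[ M ] SameLaxLattice (cols M) (a , b))
proposition3p2 = columns-isBasis , sameCircle⇒sameLax , sameLax⇒sameCircle , basis⇒matrix
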